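{- A proper set system is a vf-safe delta-matroid if and only if it has no $3$-minor that is isomorphic to a twisted dual of $S_3=(\{e_1,e_2,e_3\},\{\emptyset,\{e_1,e_2,e_3\}\})$.
   Context: A set system is a pair $S=(E,\mathcal F)$ where $E$ is a finite set and $\mathcal F$ is a collection of subsets of $E$ (the feasible sets); $S$ is proper if $\mathcal F\neq\emptyset$. Two set systems are isomorphic if some bijection between their ground sets maps the feasible sets of one onto the feasible sets of the other. A delta-matroid is a proper set system such that for all $X,Y\in\mathcal F$ and all $u\in X\triangle Y$ there is $v\in X\triangle Y$ (possibly $v=u$) with $X\triangle\{u,v\}\in\mathcal F$. For $e\in E$: $e$ is a loop if it lies in no feasible set, and a coloop if it lies in every feasible set. If $e$ is not a loop, the contraction is $S/e=(E-e,\{F-e: e\in F\in\mathcal F\})$; if $e$ is not a coloop, the deletion is $S\setminus e=(E-e,\{F\in\mathcal F: e\notin F\})$; if $e$ is a loop or a coloop, whichever of $S/e$, $S\setminus e$ is undefined is set equal to the other. For $A\subseteq E$, the twist is $S*A=(E,\{F\triangle A: F\in\mathcal F\})$, and the loop complementation $S+A$ is the set system on $E$ in which $F\subseteq E$ is feasible if and only if $S$ has an odd number of feasible sets $F'$ with $F-A\subseteq F'\subseteq F$ (write $S+e$ for $S+\{e\}$). A twisted dual of $S$ is any set system obtained from $S$ by a finite sequence of twists and loop complementations. The Penrose contraction of $e$ is $S\ddagger e=(S+e)/e$. A $3$-minor of $S$ is any set system obtained from $S$ by a finite (possibly empty) sequence of single-element deletions, contractions and Penrose contractions. A delta-matroid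 is vf-safe if all of its twisted duals are delta-matroids. -}

module Defs where

open import Data.Nat using (ℕ; zero; suc)
open import Data.Bool using (Bool; true; false; not; _∧_; _∨_; _xor_; if_then_else_)
open import Data.Fin using (Fin)
open import Data.Fin.Subset using (Subset; _∪_; _─_; ⁅_⁆; _∈_)
open import Data.Vec using (Vec; []; _∷_; lookup; tabulate; insertAt; zipWith; foldr)
open import Data.List as List using (List; _++_)
open import Data.Product using (Σ; _×_; ∃; ∃-syntax)
open import Relation.Binary.PropositionalEquality using (_≡_)
open import Relation.Nullary using (¬_)
open import Function.Bundles using (_↔_; Inverse)

SetSystem : ℕ → Set
SetSystem n = Subset n → Bool

Feasible : ∀ {n} → SetSystem n → Subset n → Set
Feasible S F = S F ≡ true

Proper : ∀ {n} → SetSystem n → Set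
Proper S = ∃[ F ] Feasible S F

_△_ : ∀ {n} → Subset n → Subset n → Subset n
X △ Y = zipWith _xor_ X Y

_⊆ᵇ_ : ∀ {n} → Subset n → Subset n → Bool
[] ⊆ᵇ [] = true
(x ∷ xs) ⊆ᵇ (y ∷ ys) = (not x ∨ y) ∧ (xs ⊆ᵇ ys)

allSubsets : (n : ℕ) → List (Subset n)
allSubsets zero = List.[ [] ]
allSubsets (suc n) = List.map (false ∷_) (allSubsets n) ++ List.map (true ∷_) (allSubsets n)

DeltaMatroid : ∀ {n} → SetSystem n → Set
DeltaMatroid {n} S =
  Proper S ×
  (∀ X Y → Feasible S X → Feasible S Y → ∀ (u : Fin n) → u ∈ (X △ Y) →
     ∃[ v ] (v ∈ (X △ Y) × Feasible S (X △ (⁅ u ⁆ ∪ ⁅ v ⁆))))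

isLoop : ∀ {n} → SetSystem n → Fin n → Bool
isLoop {n} S e = not (List.foldr (λ F b → (S F ∧ lookup F e) ∨ b) false (allSubsets n))

isColoop : ∀ {n} → SetSystem n → Fin n → Bool
isColoop {n} S e = List.foldr (λ F b → (not (S F) ∨ lookup F e) ∧ b) true (allSubsets n)

-- raw contraction / deletion; subsets of Fin k are identified with subsets of
-- Fin (suc k) - e via insertAt
contractRaw : ∀ {k} → SetSystem (suc k) → Fin (suc k) → SetSystem k
contractRaw S e F = S (insertAt F e true)

deleteRaw : ∀ {k} → SetSystem (suc k) → Fin (suc k) → SetSystem k
deleteRaw S e F = S (insertAt F e false)

contract : ∀ {k} → SetSystem (suc k) → Fin (suc k) → SetSystem k
contract S e = if isLoop S e then deleteRaw S e else contractRaw S e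

delete : ∀ {k} → SetSystem (suc k) → Fin (suc k) → SetSystem k
delete S e = if isColoop S e then contractRaw S e else deleteRaw S e

twist : ∀ {n} → SetSystem n → Subset n → SetSystem n
twist S A F = S (F △ A)

-- loop complementation S + A: F feasible iff the number of feasible F'
-- with F - A ⊆ F' ⊆ F is odd (parity computed by xor-folding)
loopCompl : ∀ {n} → SetSystem n → Subset n → SetSystem n
loopCompl {n} S A F =
  List.foldr (λ F' b → (S F' ∧ ((F ─ A) ⊆ᵇ F') ∧ (F' ⊆ᵇ F)) xor b) false (allSubsets n)

penrose : ∀ {k} → SetSystem (suc k) → Fin (suc k) → SetSystem k
penrose S e = contract (loopCompl S ⁅ e ⁆) e

data TwistedDual {n} (S : SetSystem n) : SetSystem n → Set where
  td-refl  : TwistedDual S S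
  td-twist : ∀ {T} → TwistedDual S T → (A : Subset n) → TwistedDual S (twist T A)
  td-lc    : ∀ {T} → TwistedDual S T → (A : Subset n) → TwistedDual S (loopCompl T A)

VfSafe : ∀ {n} → SetSystem n → Set
VfSafe S = DeltaMatroid S × (∀ T → TwistedDual S T → DeltaMatroid T)

data ThreeMinor {n} (S : SetSystem n) : ∀ {m} → SetSystem m → Set where
  tm-refl     : ThreeMinor S S
  tm-delete   : ∀ {k} {M : SetSystem (suc k)} → ThreeMinor S M → (e : Fin (suc k)) → ThreeMinor S (delete M e)
  tm-contract : ∀ {k} {M : SetSystem (suc k)} → ThreeMinor S M → (e : Fin (suc k)) → ThreeMinor S (contract M e)
  tm-penrose  : ∀ {k} {M : SetSystem (suc k)} → ThreeMinor S M → (e : Fin (suc k)) → ThreeMinor S (penrose M e)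

imageSub : ∀ {n m} → (Fin n ↔ Fin m) → Subset n → Subset m
imageSub σ F = tabulate (λ j → lookup F (Inverse.from σ j))

Isomorphic : ∀ {n m} → SetSystem n → SetSystem m → Set
Isomorphic {n} {m} S T = Σ (Fin n ↔ Fin m) λ σ → ∀ F → S F ≡ T (imageSub σ F)

S₃ : SetSystem 3
S₃ (false ∷ false ∷ false ∷ []) = true
S₃ (true ∷ true ∷ true ∷ []) = true
S₃ _ = false

HasBadMinor : ∀ {n} → SetSystem n → Set
HasBadMinor S = ∃[ m ] Σ (SetSystem m) λ M → ThreeMinor S M ×
  (∃[ T ] (TwistedDual S₃ T × Isomorphic M T))

module Submission where

-- Each
-- of deletion, contraction and Penrose contraction at e "selects" one of two
-- slices at e, and hence a minor operation after a twist or loop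
-- complementation is a minor operation before the restricted one
-- (minor-apply).  Two consequences drive the proof:
--   * twisted duals of 3-minors of S are closed under 3-minors and twisted
--     duals (twistedMinor-threeMinor), and
--   * each of them is an iterated slice of a twisted dual of S (sliceOfDual).
-- Forward direction: exchange passes to slices, so every twisted dual of a
-- 3-minor of a vf-safe S satisfies exchange; but twisted duals of S₃ are pair
-- systems, which normalise to the system {∅, E}, violating exchange.
-- Backward direction: by induction on the ground set, a system none of whose
-- twisted 3-minors equals S₃ satisfies exchange (exchange-S₃Free): slice where
-- X and Y agree, otherwise twist to X = ∅, Y = E; three elements is a finite
-- check, four or more use the three minors at a further element.

open import Defs
open import Data.Nat using (ℕ; zero; suc)
open import Data.Bool as Bool using (Bool; true; false; not; _∧_; _∨_; _xor_; if_then_else_)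
open import Data.Bool.Properties
  using (xor-assoc; xor-comm; xor-same; xor-identityʳ; ∧-zeroʳ; ∧-identityʳ; ∨-zeroʳ; ∧-distribʳ-xor;
         ¬-not; not-injective; ⇔→≡; xor-∧-commutativeRing)
open import Data.Bool.ListAction using (all; any)
open import Data.Empty using (⊥; ⊥-elim)
open import Data.Fin using (Fin; zero; suc; punchIn; punchOut; _≟_)
open import Data.Fin.Properties using (punchIn-punchOut; punchIn-injective; punchInᵢ≢i; any?)
open import Data.Fin.Subset using (Subset; _∪_; _─_; ⁅_⁆; _∈_) renaming (⊥ to ∅; ⊤ to Full)
open import Data.Fin.Subset.Properties using (anySubset?; _∈?_; x∈⁅x⁆; x≢y⇒x∉⁅y⁆)
open import Data.List as List using (List; _++_)
open import Data.List.Properties using (unfold-reverse)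
open import Data.List.Membership.Propositional using () renaming (_∈_ to _∈ₗ_)
open import Data.List.Membership.Propositional.Properties using (∈-++⁺ˡ; ∈-++⁺ʳ; ∈-map⁺; ∈-cartesianProduct⁺)
open import Data.List.Relation.Unary.All as All using (All)
open import Data.List.Relation.Unary.All.Properties using (all⁺; all⁻)
open import Data.List.Relation.Unary.Any using (here; there; satisfied)
open import Data.List.Relation.Unary.Any.Properties using (any⁻)
open import Data.Product using (Σ; _×_; _,_; ∃-syntax; proj₁; proj₂)
open import Data.Sum using (_⊎_; inj₁; inj₂)
open import Data.Vec using (Vec; []; _∷_; lookup; tabulate; insertAt; removeAt; zipWith)
open import Data.Vec.Properties
  using (zipWith-comm; lookup-replicate; lookup-zipWith; lookup∘tabulate; tabulate∘lookup; insertAt-lookup;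
         insertAt-punchIn; insertAt-removeAt; removeAt-insertAt; []=⇒lookup; lookup⇒[]=)
open import Function using (case_of_)
open import Function.Bundles using (_↔_; Inverse; mk⇔)
open import Function.Construct.Identity using (↔-id)
open import Relation.Binary.PropositionalEquality
open import Relation.Nullary using (¬_; Dec; yes; no)
open import Relation.Nullary.Decidable using (isYes; toWitness; _×-dec_)
open import Algebra.Bundles using (CommutativeRing)
open import Algebra.Properties.CommutativeSemigroup
  (CommutativeRing.+-commutativeSemigroup xor-∧-commutativeRing) using (interchange)

infix 4 _≐_
_≐_ : ∀ {n} → SetSystem n → SetSystem n → Set
S ≐ S′ = ∀ F → S F ≡ S′ F

Null : ∀ {n} → SetSystem n → Set
Null S = ∀ F → S F ≡ false

properOrNull : ∀ {n} (S : SetSystem n) → Proper S ⊎ Null S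
properOrNull S with anySubset? (λ F → S F Bool.≟ true)
... | yes feasible = inj₁ feasible
... | no none = inj₂ (λ F → ¬-not (λ SF → none (F , SF)))

feasible⇒¬null : ∀ {n} {S : SetSystem n} {F} → S F ≡ true → ¬ Null S
feasible⇒¬null {F = F} SF null with trans (sym (null F)) SF
... | ()

slice : ∀ {k} → SetSystem (suc k) → Fin (suc k) → Bool → SetSystem k
slice S e b F = S (insertAt F e b)

infixl 6 _⊕_
_⊕_ : ∀ {n} → SetSystem n → SetSystem n → SetSystem n
(S ⊕ S′) F = S F xor S′ F

Exchange : ∀ {n} → SetSystem n → Set
Exchange {n} S = ∀ X Y → Feasible S X → Feasible S Y → ∀ (u : Fin n) → u ∈ (X △ Y) →
  ∃[ v ] (v ∈ (X △ Y) × Feasible S (X △ (⁅ u ⁆ ∪ ⁅ v ⁆)))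

zipWith-insertAt : ∀ {n} {A B C : Set} (f : A → B → C) (xs : Vec A n) (ys : Vec B n)
  (e : Fin (suc n)) a b → zipWith f (insertAt xs e a) (insertAt ys e b) ≡ insertAt (zipWith f xs ys) e (f a b)
zipWith-insertAt f xs ys zero a b = refl
zipWith-insertAt f (x ∷ xs) (y ∷ ys) (suc e) a b = cong (f x y ∷_) (zipWith-insertAt f xs ys e a b)

insertAt-∅ : ∀ {n} (e : Fin (suc n)) → insertAt ∅ e false ≡ ∅
insertAt-∅ zero = refl
insertAt-∅ {suc n} (suc e) = cong (false ∷_) (insertAt-∅ e)

insertAt-Full : ∀ {n} (e : Fin (suc n)) → insertAt Full e true ≡ Full
insertAt-Full zero = refl
insertAt-Full {suc n} (suc e) = cong (true ∷_) (insertAt-Full e)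

insertAt-⁅⁆ : ∀ {n} (e : Fin (suc n)) (u : Fin n) → insertAt ⁅ u ⁆ e false ≡ ⁅ punchIn e u ⁆
insertAt-⁅⁆ zero u = refl
insertAt-⁅⁆ (suc e) zero = cong (true ∷_) (insertAt-∅ e)
insertAt-⁅⁆ (suc e) (suc u) = cong (false ∷_) (insertAt-⁅⁆ e u)

insertAt-∅-true : ∀ {n} (e : Fin (suc n)) → insertAt ∅ e true ≡ ⁅ e ⁆
insertAt-∅-true zero = refl
insertAt-∅-true {suc n} (suc e) = cong (false ∷_) (insertAt-∅-true e)

insertAt-removeAt′ : ∀ {k} (F : Subset (suc k)) e {c} → lookup F e ≡ c → insertAt (removeAt F e) e c ≡ F
insertAt-removeAt′ F e refl = insertAt-removeAt F e

punchIn-view : ∀ {n} (e j : Fin (suc n)) → j ≡ e ⊎ ∃[ j′ ] j ≡ punchIn e j′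
punchIn-view e j with e ≟ j
... | yes e≡j = inj₁ (sym e≡j)
... | no e≢j = inj₂ (punchOut e≢j , sym (punchIn-punchOut e≢j))

xor-interchange : ∀ a b c d → (a xor b) xor (c xor d) ≡ (a xor c) xor (b xor d)
xor-interchange = interchange

xor≡false⇒≡ : ∀ {a b} → a xor b ≡ false → a ≡ b
xor≡false⇒≡ {false} {false} _ = refl
xor≡false⇒≡ {true} {true} _ = refl

xorSum : ∀ {n} → (Subset n → Bool) → List (Subset n) → Bool
xorSum h = List.foldr (λ F b → h F xor b) false

xorSum-++ : ∀ {n} (h : Subset n → Bool) xs ys → xorSum h (xs ++ ys) ≡ xorSum h xs xor xorSum h ys
xorSum-++ h List.[] ys = refl
xorSum-++ h (x List.∷ xs) ys = trans (cong (h x xor_) (xorSum-++ h xs ys)) (sym (xor-assoc (h x) _ _))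

xorSum-map : ∀ {m n} (h : Subset n → Bool) (g : Subset m → Subset n) xs →
  xorSum h (List.map g xs) ≡ xorSum (λ F → h (g F)) xs
xorSum-map h g List.[] = refl
xorSum-map h g (x List.∷ xs) = cong (h (g x) xor_) (xorSum-map h g xs)

xorSum-false : ∀ {n} (h : Subset n → Bool) → (∀ F → h F ≡ false) → ∀ xs → xorSum h xs ≡ false
xorSum-false h h≡false List.[] = refl
xorSum-false h h≡false (x List.∷ xs) rewrite h≡false x = xorSum-false h h≡false xs

xorSum-allSubsets : ∀ {n} (h : Subset (suc n) → Bool) → xorSum h (allSubsets (suc n)) ≡
  xorSum (λ F → h (false ∷ F)) (allSubsets n) xor xorSum (λ F → h (true ∷ F)) (allSubsets n)
xorSum-allSubsets {n} h = trans (xorSum-++ h (List.map (false ∷_) (allSubsets n)) (List.map (true ∷_) (allSubsets n)))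
  (cong₂ _xor_ (xorSum-map h (false ∷_) (allSubsets n)) (xorSum-map h (true ∷_) (allSubsets n)))

lcRec : ∀ {n} → SetSystem n → Subset n → SetSystem n
lcRec {zero} S [] [] = S []
lcRec {suc n} S (a ∷ A) (false ∷ F) = lcRec (λ G → S (false ∷ G)) A F
lcRec {suc n} S (false ∷ A) (true ∷ F) = lcRec (λ G → S (true ∷ G)) A F
lcRec {suc n} S (true ∷ A) (true ∷ F) = lcRec (λ G → S (false ∷ G)) A F xor lcRec (λ G → S (true ∷ G)) A F

lcTerm : ∀ {n} → SetSystem n → Subset n → Subset n → Subset n → Bool
lcTerm S A F F′ = S F′ ∧ ((F ─ A) ⊆ᵇ F′) ∧ (F′ ⊆ᵇ F)

-- Sets F′ with F′ ⊈ F contribute nothing to the sum.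
∧-∧-false : ∀ x y → x ∧ (y ∧ false) ≡ false
∧-∧-false x y = trans (cong (x ∧_) (∧-zeroʳ y)) (∧-zeroʳ x)

loopCompl≐lcRec : ∀ {n} (S : SetSystem n) A → loopCompl S A ≐ lcRec S A
loopCompl≐lcRec {zero} S [] [] = trans (xor-identityʳ _) (∧-identityʳ _)
loopCompl≐lcRec {suc n} S (false ∷ A) (false ∷ F) =
  trans (xorSum-allSubsets (lcTerm S (false ∷ A) (false ∷ F)))
    (trans (cong₂ _xor_ (loopCompl≐lcRec (λ G → S (false ∷ G)) A F)
                        (xorSum-false _ (λ G → ∧-∧-false (S (true ∷ G)) _) (allSubsets n)))
           (xor-identityʳ _))
loopCompl≐lcRec {suc n} S (true ∷ A) (false ∷ F) =
  trans (xorSum-allSubsets (lcTerm S (true ∷ A) (false ∷ F)))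
    (trans (cong₂ _xor_ (loopCompl≐lcRec (λ G → S (false ∷ G)) A F)
                        (xorSum-false _ (λ G → ∧-∧-false (S (true ∷ G)) _) (allSubsets n)))
           (xor-identityʳ _))
loopCompl≐lcRec {suc n} S (false ∷ A) (true ∷ F) =
  trans (xorSum-allSubsets (lcTerm S (false ∷ A) (true ∷ F)))
    (cong₂ _xor_ (xorSum-false _ (λ G → ∧-zeroʳ (S (false ∷ G))) (allSubsets n))
                 (loopCompl≐lcRec (λ G → S (true ∷ G)) A F))
loopCompl≐lcRec {suc n} S (true ∷ A) (true ∷ F) =
  trans (xorSum-allSubsets (lcTerm S (true ∷ A) (true ∷ F)))
    (cong₂ _xor_ (loopCompl≐lcRec (λ G → S (false ∷ G)) A F) (loopCompl≐lcRec (λ G → S (true ∷ G)) A F))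

lcRec-cong : ∀ {n} {S S′ : SetSystem n} → S ≐ S′ → ∀ A → lcRec S A ≐ lcRec S′ A
lcRec-cong {zero} S≐S′ [] [] = S≐S′ []
lcRec-cong {suc n} S≐S′ (a ∷ A) (false ∷ F) = lcRec-cong (λ G → S≐S′ (false ∷ G)) A F
lcRec-cong {suc n} S≐S′ (false ∷ A) (true ∷ F) = lcRec-cong (λ G → S≐S′ (true ∷ G)) A F
lcRec-cong {suc n} S≐S′ (true ∷ A) (true ∷ F) =
  cong₂ _xor_ (lcRec-cong (λ G → S≐S′ (false ∷ G)) A F) (lcRec-cong (λ G → S≐S′ (true ∷ G)) A F)

lcRec-null : ∀ {n} {S : SetSystem n} → Null S → ∀ A → Null (lcRec S A)
lcRec-null {zero} null [] [] = null []
lcRec-null {suc n} null (a ∷ A) (false ∷ F) = lcRec-null (λ G → null (false ∷ G)) A F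
lcRec-null {suc n} null (false ∷ A) (true ∷ F) = lcRec-null (λ G → null (true ∷ G)) A F
lcRec-null {suc n} null (true ∷ A) (true ∷ F) =
  cong₂ _xor_ (lcRec-null (λ G → null (false ∷ G)) A F) (lcRec-null (λ G → null (true ∷ G)) A F)

lcRec-⊕ : ∀ {n} (S S′ : SetSystem n) A → lcRec (S ⊕ S′) A ≐ lcRec S A ⊕ lcRec S′ A
lcRec-⊕ {zero} S S′ [] [] = refl
lcRec-⊕ {suc n} S S′ (a ∷ A) (false ∷ F) = lcRec-⊕ _ _ A F
lcRec-⊕ {suc n} S S′ (false ∷ A) (true ∷ F) = lcRec-⊕ _ _ A F
lcRec-⊕ {suc n} S S′ (true ∷ A) (true ∷ F) =
  trans (cong₂ _xor_ (lcRec-⊕ S₀ S′₀ A F) (lcRec-⊕ S₁ S′₁ A F))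
        (xor-interchange (lcRec S₀ A F) (lcRec S′₀ A F) (lcRec S₁ A F) (lcRec S′₁ A F))
  where
  S₀ S₁ S′₀ S′₁ : SetSystem n
  S₀ G = S (false ∷ G)
  S₁ G = S (true ∷ G)
  S′₀ G = S′ (false ∷ G)
  S′₁ G = S′ (true ∷ G)

lcRec-∅ : ∀ {n} (S : SetSystem n) → lcRec S ∅ ≐ S
lcRec-∅ {zero} S [] = refl
lcRec-∅ {suc n} S (false ∷ F) = lcRec-∅ _ F
lcRec-∅ {suc n} S (true ∷ F) = lcRec-∅ _ F

x-xor-x-xor-y : ∀ x y → x xor (x xor y) ≡ y
x-xor-x-xor-y x y = trans (sym (xor-assoc x x y)) (cong (_xor y) (xor-same x))

lcRec-involutive : ∀ {n} (S : SetSystem n) A → lcRec (lcRec S A) A ≐ S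
lcRec-involutive {zero} S [] [] = refl
lcRec-involutive {suc n} S (a ∷ A) (false ∷ F) = lcRec-involutive _ A F
lcRec-involutive {suc n} S (false ∷ A) (true ∷ F) = lcRec-involutive _ A F
lcRec-involutive {suc n} S (true ∷ A) (true ∷ F) =
  trans (cong₂ _xor_ (lcRec-involutive S₀ A F)
          (trans (lcRec-⊕ (lcRec S₀ A) (lcRec S₁ A) A F)
                 (cong₂ _xor_ (lcRec-involutive S₀ A F) (lcRec-involutive S₁ A F))))
        (x-xor-x-xor-y (S (false ∷ F)) (S (true ∷ F)))
  where
  S₀ S₁ : SetSystem n
  S₀ G = S (false ∷ G)
  S₁ G = S (true ∷ G)

lcRec-slice-false : ∀ {k} (S : SetSystem (suc k)) e A a F →
  lcRec S (insertAt A e a) (insertAt F e false) ≡ lcRec (slice S e false) A F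
lcRec-slice-false S zero A a F = refl
lcRec-slice-false S (suc e) (a′ ∷ A) a (false ∷ F) = lcRec-slice-false _ e A a F
lcRec-slice-false S (suc e) (false ∷ A) a (true ∷ F) = lcRec-slice-false _ e A a F
lcRec-slice-false S (suc e) (true ∷ A) a (true ∷ F) =
  cong₂ _xor_ (lcRec-slice-false _ e A a F) (lcRec-slice-false _ e A a F)

lcRec-slice-true : ∀ {k} (S : SetSystem (suc k)) e A F →
  lcRec S (insertAt A e false) (insertAt F e true) ≡ lcRec (slice S e true) A F
lcRec-slice-true S zero A F = refl
lcRec-slice-true S (suc e) (a′ ∷ A) (false ∷ F) = lcRec-slice-true _ e A F
lcRec-slice-true S (suc e) (false ∷ A) (true ∷ F) = lcRec-slice-true _ e A F
lcRec-slice-true S (suc e) (true ∷ A) (true ∷ F) =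
  cong₂ _xor_ (lcRec-slice-true _ e A F) (lcRec-slice-true _ e A F)

lcRec-slice-true-∈ : ∀ {k} (S : SetSystem (suc k)) e A F →
  lcRec S (insertAt A e true) (insertAt F e true) ≡ lcRec (slice S e false) A F xor lcRec (slice S e true) A F
lcRec-slice-true-∈ S zero A F = refl
lcRec-slice-true-∈ S (suc e) (a′ ∷ A) (false ∷ F) = lcRec-slice-true-∈ _ e A F
lcRec-slice-true-∈ S (suc e) (false ∷ A) (true ∷ F) = lcRec-slice-true-∈ _ e A F
lcRec-slice-true-∈ S (suc e) (true ∷ A) (true ∷ F) =
  trans (cong₂ _xor_ (lcRec-slice-true-∈ S₀ e A F) (lcRec-slice-true-∈ S₁ e A F))
        (xor-interchange (lcRec (slice S₀ e false) A F) (lcRec (slice S₀ e true) A F)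
                         (lcRec (slice S₁ e false) A F) (lcRec (slice S₁ e true) A F))
  where
  S₀ S₁ : SetSystem _
  S₀ G = S (false ∷ G)
  S₁ G = S (true ∷ G)

∈-allSubsets : ∀ {n} (F : Subset n) → F ∈ₗ allSubsets n
∈-allSubsets [] = here refl
∈-allSubsets {suc n} (false ∷ F) = ∈-++⁺ˡ (∈-map⁺ (false ∷_) (∈-allSubsets F))
∈-allSubsets {suc n} (true ∷ F) = ∈-++⁺ʳ (List.map (false ∷_) (allSubsets n)) (∈-map⁺ (true ∷_) (∈-allSubsets F))

and-fold⁻ : ∀ {A : Set} (p : A → Bool) xs →
  List.foldr (λ x b → p x ∧ b) true xs ≡ true → All (λ x → p x ≡ true) xs
and-fold⁻ p List.[] _ = All.[]
and-fold⁻ p (x List.∷ xs) holds with p x in px | holds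
... | true | holds′ = px All.∷ and-fold⁻ p xs holds′

and-fold⁺ : ∀ {A : Set} (p : A → Bool) xs →
  All (λ x → p x ≡ true) xs → List.foldr (λ x b → p x ∧ b) true xs ≡ true
and-fold⁺ p List.[] All.[] = refl
and-fold⁺ p (x List.∷ xs) (px All.∷ pxs) rewrite px = and-fold⁺ p xs pxs

or-fold⁻ : ∀ {A : Set} (p : A → Bool) xs →
  List.foldr (λ x b → p x ∨ b) false xs ≡ false → All (λ x → p x ≡ false) xs
or-fold⁻ p List.[] _ = All.[]
or-fold⁻ p (x List.∷ xs) fails with p x in px | fails
... | false | fails′ = px All.∷ or-fold⁻ p xs fails′

or-fold⁺ : ∀ {A : Set} (p : A → Bool) xs →
  All (λ x → p x ≡ false) xs → List.foldr (λ x b → p x ∨ b) false xs ≡ false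
or-fold⁺ p List.[] All.[] = refl
or-fold⁺ p (x List.∷ xs) (px All.∷ pxs) rewrite px = or-fold⁺ p xs pxs

coloop⇒null : ∀ {k} (S : SetSystem (suc k)) e → isColoop S e ≡ true → Null (slice S e false)
coloop⇒null {k} S e coloop F with All.lookup (and-fold⁻ _ (allSubsets (suc k)) coloop) (∈-allSubsets (insertAt F e false))
... | avoids rewrite insertAt-lookup F e false with S (insertAt F e false) | avoids
...   | false | _ = refl

null⇒coloop : ∀ {k} (S : SetSystem (suc k)) e → Null (slice S e false) → isColoop S e ≡ true
null⇒coloop {k} S e null = and-fold⁺ _ (allSubsets (suc k)) (All.tabulate (λ {F} _ → contains F))
  where
  contains : ∀ F → (not (S F) ∨ lookup F e) ≡ true
  contains F with lookup F e in F∋e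
  ... | true = ∨-zeroʳ _
  ... | false rewrite sym (insertAt-removeAt′ F e F∋e) | null (removeAt F e) = refl

loop⇒null : ∀ {k} (S : SetSystem (suc k)) e → isLoop S e ≡ true → Null (slice S e true)
loop⇒null {k} S e loop F with All.lookup (or-fold⁻ _ (allSubsets (suc k)) (not-injective loop)) (∈-allSubsets (insertAt F e true))
... | absent rewrite insertAt-lookup F e true with S (insertAt F e true) | absent
...   | false | _ = refl

null⇒loop : ∀ {k} (S : SetSystem (suc k)) e → Null (slice S e true) → isLoop S e ≡ true
null⇒loop {k} S e null = cong not (or-fold⁺ _ (allSubsets (suc k)) (All.tabulate (λ {F} _ → avoids F)))
  where
  avoids : ∀ F → (S F ∧ lookup F e) ≡ false
  avoids F with lookup F e in F∋e
  ... | false = ∧-zeroʳ _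
  ... | true rewrite sym (insertAt-removeAt′ F e F∋e) | null (removeAt F e) = refl

-- h selects f over g: h is f unless f is null, in which case h is g.
-- Deletion, contraction and Penrose contraction all select between two slices.
Selects : ∀ {n} → SetSystem n → SetSystem n → SetSystem n → Set
Selects f g h = (Null f → h ≐ g) × (¬ Null f → h ≐ f)

selects-resp : ∀ {n} {f f′ g g′ h : SetSystem n} → f ≐ f′ → g ≐ g′ → Selects f g h → Selects f′ g′ h
selects-resp f≐f′ g≐g′ (ifNull , ifProper) =
  (λ null F → trans (ifNull (λ G → trans (f≐f′ G) (null G)) F) (g≐g′ F)) ,
  (λ ¬null F → trans (ifProper (λ null → ¬null (λ G → trans (sym (f≐f′ G)) (null G))) F) (f≐f′ F))

selects-fallback : ∀ {n} {f g g′ h : SetSystem n} → (Null f → g ≐ g′) → Selects f g h → Selects f g′ h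
selects-fallback g≐g′ (ifNull , ifProper) = (λ null F → trans (ifNull null F) (g≐g′ null F)) , ifProper

selects-unique : ∀ {n} {f g h h′ : SetSystem n} → Selects f g h → Selects f g h′ → h ≐ h′
selects-unique {f = f} (ifNull , ifProper) (ifNull′ , ifProper′) with properOrNull f
... | inj₁ (F , fF) = λ G → trans (ifProper (feasible⇒¬null fF) G) (sym (ifProper′ (feasible⇒¬null fF) G))
... | inj₂ null = λ G → trans (ifNull null G) (sym (ifNull′ null G))

delete-selects : ∀ {k} (S : SetSystem (suc k)) e → Selects (slice S e false) (slice S e true) (delete S e)
delete-selects S e with isColoop S e in coloop
... | true = (λ _ F → refl) , (λ ¬null → ⊥-elim (¬null (coloop⇒null S e coloop)))
... | false = (λ null → case trans (sym coloop) (null⇒coloop S e null) of λ ()) , (λ _ F → refl)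

contract-selects : ∀ {k} (S : SetSystem (suc k)) e → Selects (slice S e true) (slice S e false) (contract S e)
contract-selects S e with isLoop S e in loop
... | true = (λ _ F → refl) , (λ ¬null → ⊥-elim (¬null (loop⇒null S e loop)))
... | false = (λ null → case trans (sym loop) (null⇒loop S e null) of λ ()) , (λ _ F → refl)

-- S ‡ e selects the xor of the two slices at e over the slice avoiding e,
-- since loop complementation at e only changes the slice containing e.
penrose-selects : ∀ {k} (S : SetSystem (suc k)) e →
  Selects (slice S e false ⊕ slice S e true) (slice S e false) (penrose S e)
penrose-selects S e = selects-resp withE withoutE (contract-selects (loopCompl S ⁅ e ⁆) e)
  where
  withE : slice (loopCompl S ⁅ e ⁆) e true ≐ slice S e false ⊕ slice S e true
  withE F = begin
    loopCompl S ⁅ e ⁆ (insertAt F e true)           ≡⟨ loopCompl≐lcRec S _ _ ⟩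
    lcRec S ⁅ e ⁆ (insertAt F e true)               ≡⟨ cong (λ A → lcRec S A (insertAt F e true)) (sym (insertAt-∅-true e)) ⟩
    lcRec S (insertAt ∅ e true) (insertAt F e true) ≡⟨ lcRec-slice-true-∈ S e ∅ F ⟩
    lcRec (slice S e false) ∅ F xor lcRec (slice S e true) ∅ F ≡⟨ cong₂ _xor_ (lcRec-∅ _ F) (lcRec-∅ _ F) ⟩
    slice S e false F xor slice S e true F          ∎
    where open ≡-Reasoning
  withoutE : slice (loopCompl S ⁅ e ⁆) e false ≐ slice S e false
  withoutE F = begin
    loopCompl S ⁅ e ⁆ (insertAt F e false)           ≡⟨ loopCompl≐lcRec S _ _ ⟩
    lcRec S ⁅ e ⁆ (insertAt F e false)               ≡⟨ cong (λ A → lcRec S A (insertAt F e false)) (sym (insertAt-∅-true e)) ⟩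
    lcRec S (insertAt ∅ e true) (insertAt F e false) ≡⟨ lcRec-slice-false S e ∅ true F ⟩
    lcRec (slice S e false) ∅ F                      ≡⟨ lcRec-∅ _ F ⟩
    slice S e false F                                ∎
    where open ≡-Reasoning

data Op (n : ℕ) : Set where
  tw lc : Subset n → Op n

apply : ∀ {n} → Op n → SetSystem n → SetSystem n
apply (tw A) S = twist S A
apply (lc A) S = loopCompl S A

△-involutive : ∀ {n} (F A : Subset n) → (F △ A) △ A ≡ F
△-involutive [] [] = refl
△-involutive (f ∷ F) (a ∷ A) =
  cong₂ _∷_ (trans (xor-assoc f a a) (trans (cong (f xor_) (xor-same a)) (xor-identityʳ f))) (△-involutive F A)

apply-cong : ∀ {n} (o : Op n) {S S′ : SetSystem n} → S ≐ S′ → apply o S ≐ apply o S′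
apply-cong (tw A) S≐S′ F = S≐S′ (F △ A)
apply-cong (lc A) {S} {S′} S≐S′ F =
  trans (loopCompl≐lcRec S A F) (trans (lcRec-cong S≐S′ A F) (sym (loopCompl≐lcRec S′ A F)))

apply-involutive : ∀ {n} (o : Op n) (S : SetSystem n) → apply o (apply o S) ≐ S
apply-involutive (tw A) S F = cong S (△-involutive F A)
apply-involutive (lc A) S F =
  trans (loopCompl≐lcRec _ A F) (trans (lcRec-cong (loopCompl≐lcRec S A) A F) (lcRec-involutive S A F))

apply-null : ∀ {n} (o : Op n) {S : SetSystem n} → Null S → Null (apply o S)
apply-null (tw A) null F = null (F △ A)
apply-null (lc A) {S} null F = trans (loopCompl≐lcRec S A F) (lcRec-null null A F)

apply-null⁻ : ∀ {n} (o : Op n) {S : SetSystem n} → Null (apply o S) → Null S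
apply-null⁻ o {S} null F = trans (sym (apply-involutive o S F)) (apply-null o null F)

apply-⊕ : ∀ {n} (o : Op n) (S S′ : SetSystem n) → apply o (S ⊕ S′) ≐ apply o S ⊕ apply o S′
apply-⊕ (tw A) S S′ F = refl
apply-⊕ (lc A) S S′ F =
  trans (loopCompl≐lcRec _ A F) (trans (lcRec-⊕ S S′ A F) (sym (cong₂ _xor_ (loopCompl≐lcRec S A F) (loopCompl≐lcRec S′ A F))))

-- Being null is invariant under the operations, so they preserve selection.
selects-apply : ∀ {n} (o : Op n) {f g h : SetSystem n} → Selects f g h → Selects (apply o f) (apply o g) (apply o h)
selects-apply o (ifNull , ifProper) =
  (λ null → apply-cong o (ifNull (apply-null⁻ o null))) , (λ ¬null → apply-cong o (ifProper (λ null → ¬null (apply-null o null))))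

twist-slice : ∀ {k} (S : SetSystem (suc k)) A e b {c} → lookup A e ≡ c →
  slice (twist S A) e b ≐ twist (slice S e (b xor c)) (removeAt A e)
twist-slice S A e b {c} A∋e F =
  cong S (trans (cong (insertAt F e b △_) (sym (insertAt-removeAt′ A e A∋e))) (zipWith-insertAt _xor_ F (removeAt A e) e b c))

lc-slice-false : ∀ {k} (S : SetSystem (suc k)) A e →
  slice (loopCompl S A) e false ≐ loopCompl (slice S e false) (removeAt A e)
lc-slice-false S A e F = begin
  loopCompl S A (insertAt F e false)                               ≡⟨ loopCompl≐lcRec S A _ ⟩
  lcRec S A (insertAt F e false)                                   ≡⟨ cong (λ A′ → lcRec S A′ _) (sym (insertAt-removeAt A e)) ⟩
  lcRec S (insertAt (removeAt A e) e (lookup A e)) (insertAt F e false) ≡⟨ lcRec-slice-false S e (removeAt A e) _ F ⟩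
  lcRec (slice S e false) (removeAt A e) F                         ≡⟨ sym (loopCompl≐lcRec _ _ F) ⟩
  loopCompl (slice S e false) (removeAt A e) F                     ∎
  where open ≡-Reasoning

lc-slice-true-∉ : ∀ {k} (S : SetSystem (suc k)) A e → lookup A e ≡ false →
  slice (loopCompl S A) e true ≐ loopCompl (slice S e true) (removeAt A e)
lc-slice-true-∉ S A e A∌e F = begin
  loopCompl S A (insertAt F e true)                            ≡⟨ loopCompl≐lcRec S A _ ⟩
  lcRec S A (insertAt F e true)                                ≡⟨ cong (λ A′ → lcRec S A′ _) (sym (insertAt-removeAt′ A e A∌e)) ⟩
  lcRec S (insertAt (removeAt A e) e false) (insertAt F e true) ≡⟨ lcRec-slice-true S e (removeAt A e) F ⟩
  lcRec (slice S e true) (removeAt A e) F                      ≡⟨ sym (loopCompl≐lcRec _ _ F) ⟩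
  loopCompl (slice S e true) (removeAt A e) F                  ∎
  where open ≡-Reasoning

lc-slice-true-∈ : ∀ {k} (S : SetSystem (suc k)) A e → lookup A e ≡ true →
  slice (loopCompl S A) e true ≐ loopCompl (slice S e false ⊕ slice S e true) (removeAt A e)
lc-slice-true-∈ S A e A∋e F = begin
  loopCompl S A (insertAt F e true)                           ≡⟨ loopCompl≐lcRec S A _ ⟩
  lcRec S A (insertAt F e true)                               ≡⟨ cong (λ A′ → lcRec S A′ _) (sym (insertAt-removeAt′ A e A∋e)) ⟩
  lcRec S (insertAt (removeAt A e) e true) (insertAt F e true) ≡⟨ lcRec-slice-true-∈ S e (removeAt A e) F ⟩
  lcRec (slice S e false) A′ F xor lcRec (slice S e true) A′ F ≡⟨ sym (lcRec-⊕ _ _ A′ F) ⟩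
  lcRec (slice S e false ⊕ slice S e true) A′ F               ≡⟨ sym (loopCompl≐lcRec _ _ F) ⟩
  loopCompl (slice S e false ⊕ slice S e true) A′ F           ∎
  where
  open ≡-Reasoning
  A′ = removeAt A e

data MinorOp : Set where
  del con pen : MinorOp

minor : ∀ {k} → MinorOp → SetSystem (suc k) → Fin (suc k) → SetSystem k
minor del = delete
minor con = contract
minor pen = penrose

preferred fallback : ∀ {k} → MinorOp → SetSystem (suc k) → Fin (suc k) → SetSystem k
preferred del S e = slice S e false
preferred con S e = slice S e true
preferred pen S e = slice S e false ⊕ slice S e true
fallback del S e = slice S e true
fallback con S e = slice S e false
fallback pen S e = slice S e false

minor-selects : ∀ {k} φ (S : SetSystem (suc k)) e → Selects (preferred φ S e) (fallback φ S e) (minor φ S e)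
minor-selects del = delete-selects
minor-selects con = contract-selects
minor-selects pen = penrose-selects

preferred-cong : ∀ {k} φ {S S′ : SetSystem (suc k)} e → S ≐ S′ → preferred φ S e ≐ preferred φ S′ e
preferred-cong del e S≐S′ F = S≐S′ _
preferred-cong con e S≐S′ F = S≐S′ _
preferred-cong pen e S≐S′ F = cong₂ _xor_ (S≐S′ _) (S≐S′ _)

fallback-cong : ∀ {k} φ {S S′ : SetSystem (suc k)} e → S ≐ S′ → fallback φ S e ≐ fallback φ S′ e
fallback-cong del e S≐S′ F = S≐S′ _
fallback-cong con e S≐S′ F = S≐S′ _
fallback-cong pen e S≐S′ F = S≐S′ _

minor-cong : ∀ {k} φ {S S′ : SetSystem (suc k)} e → S ≐ S′ → minor φ S e ≐ minor φ S′ e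
minor-cong φ {S} {S′} e S≐S′ = selects-unique (minor-selects φ S e)
  (selects-resp (λ F → sym (preferred-cong φ e S≐S′ F)) (λ F → sym (fallback-cong φ e S≐S′ F)) (minor-selects φ S′ e))

restrict : ∀ {k} → Op (suc k) → Fin (suc k) → Op k
restrict (tw A) e = tw (removeAt A e)
restrict (lc A) e = lc (removeAt A e)

commute-via : ∀ {k} φ (o : Op k) (S : SetSystem (suc k)) e {h} →
  Selects (apply o (preferred φ S e)) (apply o (fallback φ S e)) h → Σ MinorOp λ φ′ → h ≐ apply o (minor φ′ S e)
commute-via φ o S e sel = φ , selects-unique sel (selects-apply o (minor-selects φ S e))

-- Minor operations after a twist: the same operation if e ∉ A; if e ∈ A,
-- deletion and contraction are exchanged.
minor-twist : ∀ {k} φ (S : SetSystem (suc k)) A e →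
  Σ MinorOp λ φ′ → minor φ (twist S A) e ≐ twist (minor φ′ S e) (removeAt A e)
minor-twist φ S A e = byMembership φ (lookup A e) refl
  where
  A′ = removeAt A e
  s₀ s₁ : SetSystem _
  s₀ = slice S e false
  s₁ = slice S e true
  byMembership : ∀ φ c → lookup A e ≡ c → Σ MinorOp λ φ′ → minor φ (twist S A) e ≐ twist (minor φ′ S e) A′
  byMembership del false e∉A = commute-via del (tw A′) S e
    (selects-resp (twist-slice S A e false e∉A) (twist-slice S A e true e∉A) (minor-selects del (twist S A) e))
  byMembership con false e∉A = commute-via con (tw A′) S e
    (selects-resp (twist-slice S A e true e∉A) (twist-slice S A e false e∉A) (minor-selects con (twist S A) e))
  byMembership pen false e∉A = commute-via pen (tw A′) S e (selects-resp
    (λ F → cong₂ _xor_ (twist-slice S A e false e∉A F) (twist-slice S A e true e∉A F))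
    (twist-slice S A e false e∉A) (minor-selects pen (twist S A) e))
  byMembership del true e∈A = commute-via con (tw A′) S e
    (selects-resp (twist-slice S A e false e∈A) (twist-slice S A e true e∈A) (minor-selects del (twist S A) e))
  byMembership con true e∈A = commute-via del (tw A′) S e
    (selects-resp (twist-slice S A e true e∈A) (twist-slice S A e false e∈A) (minor-selects con (twist S A) e))
  byMembership pen true e∈A = commute-via pen (tw A′) S e (selects-fallback sameSlices (selects-resp
    (λ F → trans (cong₂ _xor_ (twist-slice S A e false e∈A F) (twist-slice S A e true e∈A F)) (xor-comm (s₁ _) (s₀ _)))
    (twist-slice S A e false e∈A) (minor-selects pen (twist S A) e)))
    where
    -- the fallback matters only when the two slices have the same feasible sets
    sameSlices : Null (twist (s₀ ⊕ s₁) A′) → twist s₁ A′ ≐ twist s₀ A′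
    sameSlices null F = sym (xor≡false⇒≡ (null F))

-- Minor operations after a loop complementation: the same operation if e ∉ A;
-- if e ∈ A, contraction and Penrose contraction are exchanged.
minor-loopCompl : ∀ {k} φ (S : SetSystem (suc k)) A e →
  Σ MinorOp λ φ′ → minor φ (loopCompl S A) e ≐ loopCompl (minor φ′ S e) (removeAt A e)
minor-loopCompl φ S A e = byMembership φ (lookup A e) refl
  where
  A′ = removeAt A e
  s₀ s₁ : SetSystem _
  s₀ = slice S e false
  s₁ = slice S e true
  byMembership : ∀ φ c → lookup A e ≡ c → Σ MinorOp λ φ′ → minor φ (loopCompl S A) e ≐ loopCompl (minor φ′ S e) A′
  byMembership del false e∉A = commute-via del (lc A′) S e
    (selects-resp (lc-slice-false S A e) (lc-slice-true-∉ S A e e∉A) (minor-selects del (loopCompl S A) e))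
  byMembership con false e∉A = commute-via con (lc A′) S e
    (selects-resp (lc-slice-true-∉ S A e e∉A) (lc-slice-false S A e) (minor-selects con (loopCompl S A) e))
  byMembership pen false e∉A = commute-via pen (lc A′) S e (selects-resp
    (λ F → trans (cong₂ _xor_ (lc-slice-false S A e F) (lc-slice-true-∉ S A e e∉A F)) (sym (apply-⊕ (lc A′) s₀ s₁ F)))
    (lc-slice-false S A e) (minor-selects pen (loopCompl S A) e))
  byMembership del true e∈A = commute-via del (lc A′) S e (selects-fallback nullSlice (selects-resp
    (lc-slice-false S A e) (lc-slice-true-∈ S A e e∈A) (minor-selects del (loopCompl S A) e)))
    where
    -- if the slice avoiding e is null, xoring it into the other slice changes nothing
    nullSlice : Null (loopCompl s₀ A′) → loopCompl (s₀ ⊕ s₁) A′ ≐ loopCompl s₁ A′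
    nullSlice null = apply-cong (lc A′) (λ F → cong (_xor s₁ F) (apply-null⁻ (lc A′) {s₀} null F))
  byMembership con true e∈A = commute-via pen (lc A′) S e
    (selects-resp (lc-slice-true-∈ S A e e∈A) (lc-slice-false S A e) (minor-selects con (loopCompl S A) e))
  byMembership pen true e∈A = commute-via con (lc A′) S e (selects-resp
    (λ F → trans (cong₂ _xor_ (lc-slice-false S A e F) (lc-slice-true-∈ S A e e∈A F))
      (trans (sym (apply-⊕ (lc A′) s₀ (s₀ ⊕ s₁) F)) (apply-cong (lc A′) (λ G → x-xor-x-xor-y (s₀ G) (s₁ G)) F)))
    (lc-slice-false S A e) (minor-selects pen (loopCompl S A) e))

minor-apply : ∀ {k} φ (o : Op (suc k)) (S : SetSystem (suc k)) e →
  Σ MinorOp λ φ′ → minor φ (apply o S) e ≐ apply (restrict o e) (minor φ′ S e)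
minor-apply φ (tw A) S e = minor-twist φ S A e
minor-apply φ (lc A) S e = minor-loopCompl φ S A e

Ops : ℕ → Set
Ops n = List (Op n)

applyAll : ∀ {n} → Ops n → SetSystem n → SetSystem n
applyAll List.[] S = S
applyAll (o List.∷ os) S = applyAll os (apply o S)

applyAll-cong : ∀ {n} (os : Ops n) {S S′ : SetSystem n} → S ≐ S′ → applyAll os S ≐ applyAll os S′
applyAll-cong List.[] S≐S′ = S≐S′
applyAll-cong (o List.∷ os) S≐S′ = applyAll-cong os (apply-cong o S≐S′)

applyAll-++ : ∀ {n} (os os′ : Ops n) (S : SetSystem n) → applyAll (os ++ os′) S ≡ applyAll os′ (applyAll os S)
applyAll-++ List.[] os′ S = refl
applyAll-++ (o List.∷ os) os′ S = applyAll-++ os os′ (apply o S)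

-- Each operation is an involution, so a sequence is undone by its reverse.
applyAll-reverse : ∀ {n} (os : Ops n) (S : SetSystem n) → applyAll (List.reverse os) (applyAll os S) ≐ S
applyAll-reverse List.[] S F = refl
applyAll-reverse (o List.∷ os) S F
  rewrite unfold-reverse o os | applyAll-++ (List.reverse os) (o List.∷ List.[]) (applyAll os (apply o S)) =
  trans (apply-cong o (applyAll-reverse os (apply o S)) F) (apply-involutive o S F)

twistedDual-applyAll : ∀ {n} {S T : SetSystem n} (os : Ops n) → TwistedDual S T → TwistedDual S (applyAll os T)
twistedDual-applyAll List.[] dual = dual
twistedDual-applyAll (tw A List.∷ os) dual = twistedDual-applyAll os (td-twist dual A)
twistedDual-applyAll (lc A List.∷ os) dual = twistedDual-applyAll os (td-lc dual A)

ops-snoc : ∀ {n} {S T : SetSystem n} o → Σ (Ops n) (λ os → T ≐ applyAll os S) → Σ (Ops n) λ os → apply o T ≐ applyAll os S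
ops-snoc {S = S} o (os , T≐) =
  os ++ (o List.∷ List.[]) , λ F → trans (apply-cong o T≐ F) (sym (cong (λ S′ → S′ F) (applyAll-++ os _ S)))

twistedDual⇒ops : ∀ {n} {S T : SetSystem n} → TwistedDual S T → Σ (Ops n) λ os → T ≐ applyAll os S
twistedDual⇒ops td-refl = List.[] , λ F → refl
twistedDual⇒ops (td-twist dual A) = ops-snoc (tw A) (twistedDual⇒ops dual)
twistedDual⇒ops (td-lc dual A) = ops-snoc (lc A) (twistedDual⇒ops dual)

TwistedMinor : ∀ {n m} → SetSystem n → SetSystem m → Set
TwistedMinor {m = m} S M = Σ (SetSystem m) λ N → ThreeMinor S N × Σ (Ops m) λ os → applyAll os N ≐ M

twistedMinor-refl : ∀ {n} (S : SetSystem n) → TwistedMinor S S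
twistedMinor-refl S = S , tm-refl , List.[] , λ F → refl

twistedMinor-resp : ∀ {n m} {S : SetSystem n} {M M′ : SetSystem m} → TwistedMinor S M → M ≐ M′ → TwistedMinor S M′
twistedMinor-resp (N , minorN , os , N≐) M≐M′ = N , minorN , os , λ F → trans (N≐ F) (M≐M′ F)

twistedMinor-ops : ∀ {n m} {S : SetSystem n} {M : SetSystem m} (os′ : Ops m) → TwistedMinor S M → TwistedMinor S (applyAll os′ M)
twistedMinor-ops os′ (N , minorN , os , N≐) =
  N , minorN , os ++ os′ , λ F → trans (cong (λ S′ → S′ F) (applyAll-++ os os′ N)) (applyAll-cong os′ N≐ F)

minor-applyAll : ∀ {k} φ (os : Ops (suc k)) (T : SetSystem (suc k)) e →
  Σ MinorOp λ φ′ → minor φ (applyAll os T) e ≐ applyAll (List.map (λ o → restrict o e) os) (minor φ′ T e)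
minor-applyAll φ List.[] T e = φ , λ F → refl
minor-applyAll φ (o List.∷ os) T e with minor-applyAll φ os (apply o T) e
... | φ″ , commuteOs with minor-apply φ″ o T e
...   | φ′ , commuteO = φ′ , λ F → trans (commuteOs F) (applyAll-cong (List.map (λ o → restrict o e) os) commuteO F)

threeMinor-step : ∀ {n k} {S : SetSystem n} {M : SetSystem (suc k)} → ThreeMinor S M → ∀ φ e → ThreeMinor S (minor φ M e)
threeMinor-step minorM del e = tm-delete minorM e
threeMinor-step minorM con e = tm-contract minorM e
threeMinor-step minorM pen e = tm-penrose minorM e

twistedMinor-minor : ∀ {n k} {S : SetSystem n} {M : SetSystem (suc k)} φ e → TwistedMinor S M → TwistedMinor S (minor φ M e)
twistedMinor-minor φ e (N , minorN , os , N≐) with minor-applyAll φ os N e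
... | φ′ , commute = minor φ′ N e , threeMinor-step minorN φ′ e , List.map (λ o → restrict o e) os ,
                     λ F → trans (sym (commute F)) (minor-cong φ e N≐ F)

twistedMinor-threeMinor : ∀ {n m k} {S : SetSystem n} {Y : SetSystem m} {M : SetSystem k} →
  TwistedMinor S Y → ThreeMinor Y M → TwistedMinor S M
twistedMinor-threeMinor tY tm-refl = tY
twistedMinor-threeMinor tY (tm-delete minorM e) = twistedMinor-minor del e (twistedMinor-threeMinor tY minorM)
twistedMinor-threeMinor tY (tm-contract minorM e) = twistedMinor-minor con e (twistedMinor-threeMinor tY minorM)
twistedMinor-threeMinor tY (tm-penrose minorM e) = twistedMinor-minor pen e (twistedMinor-threeMinor tY minorM)

-- Some twisted dual of a 3-minor of S equals S₃ exactly (not just up to isomorphism).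
HasS₃Minor : ∀ {n} → SetSystem n → Set
HasS₃Minor S = Σ (SetSystem 3) λ M → TwistedMinor S M × M ≐ S₃

hasS₃Minor-transfer : ∀ {n m} {S : SetSystem n} {Y : SetSystem m} → TwistedMinor S Y → HasS₃Minor Y → HasS₃Minor S
hasS₃Minor-transfer tY (M , (N , minorN , os , N≐) , M≐S₃) =
  M , twistedMinor-resp (twistedMinor-ops os (twistedMinor-threeMinor tY minorN)) N≐ , M≐S₃

-- Undoing the operations exhibits the 3-minor as a twisted dual of S₃.
hasS₃Minor⇒hasBadMinor : ∀ {n} {S : SetSystem n} → HasS₃Minor S → HasBadMinor S
hasS₃Minor⇒hasBadMinor (M , (N , minorN , os , N≐) , M≐S₃) =
  3 , N , minorN , applyAll (List.reverse os) S₃ , twistedDual-applyAll (List.reverse os) td-refl , ↔-id _ ,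
  λ F → trans (sym (applyAll-reverse os N F))
    (trans (applyAll-cong (List.reverse os) (λ G → trans (N≐ G) (M≐S₃ G)) F)
           (cong (applyAll (List.reverse os) S₃) (sym (tabulate∘lookup F))))

exchange-resp : ∀ {n} {S S′ : SetSystem n} → S ≐ S′ → Exchange S → Exchange S′
exchange-resp S≐S′ exchange X Y SX SY u u∈ with exchange X Y (trans (S≐S′ X) SX) (trans (S≐S′ Y) SY) u u∈
... | v , v∈ , SX△uv = v , v∈ , trans (sym (S≐S′ _)) SX△uv

△-insertAt : ∀ {k} (X Y : Subset k) e c → insertAt X e c △ insertAt Y e c ≡ insertAt (X △ Y) e false
△-insertAt X Y e c = trans (zipWith-insertAt _xor_ X Y e c c) (cong (insertAt (X △ Y) e) (xor-same c))

△-pair-insertAt : ∀ {k} (X : Subset k) e c (u v : Fin k) →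
  insertAt X e c △ (⁅ punchIn e u ⁆ ∪ ⁅ punchIn e v ⁆) ≡ insertAt (X △ (⁅ u ⁆ ∪ ⁅ v ⁆)) e c
△-pair-insertAt X e c u v = begin
  insertAt X e c △ (⁅ punchIn e u ⁆ ∪ ⁅ punchIn e v ⁆)
    ≡⟨ cong₂ (λ U V → insertAt X e c △ (U ∪ V)) (sym (insertAt-⁅⁆ e u)) (sym (insertAt-⁅⁆ e v)) ⟩
  insertAt X e c △ (insertAt ⁅ u ⁆ e false ∪ insertAt ⁅ v ⁆ e false)
    ≡⟨ cong (insertAt X e c △_) (zipWith-insertAt _∨_ ⁅ u ⁆ ⁅ v ⁆ e false false) ⟩
  insertAt X e c △ insertAt (⁅ u ⁆ ∪ ⁅ v ⁆) e false
    ≡⟨ zipWith-insertAt _xor_ X (⁅ u ⁆ ∪ ⁅ v ⁆) e c false ⟩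
  insertAt (X △ (⁅ u ⁆ ∪ ⁅ v ⁆)) e (c xor false)
    ≡⟨ cong (insertAt (X △ (⁅ u ⁆ ∪ ⁅ v ⁆)) e) (xor-identityʳ c) ⟩
  insertAt (X △ (⁅ u ⁆ ∪ ⁅ v ⁆)) e c ∎
  where open ≡-Reasoning

∈-△-insertAt⁻ : ∀ {k} (X Y : Subset k) e c u → punchIn e u ∈ (insertAt X e c △ insertAt Y e c) → u ∈ (X △ Y)
∈-△-insertAt⁻ X Y e c u u∈ = lookup⇒[]= u (X △ Y)
  (trans (sym (insertAt-punchIn (X △ Y) e false u)) ([]=⇒lookup (subst (punchIn e u ∈_) (△-insertAt X Y e c) u∈)))

∈-△-insertAt⁺ : ∀ {k} (X Y : Subset k) e c u → u ∈ (X △ Y) → punchIn e u ∈ (insertAt X e c △ insertAt Y e c)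
∈-△-insertAt⁺ X Y e c u u∈ = subst (punchIn e u ∈_) (sym (△-insertAt X Y e c))
  (lookup⇒[]= (punchIn e u) _ (trans (insertAt-punchIn (X △ Y) e false u) ([]=⇒lookup u∈)))

∉-△-insertAt : ∀ {k} (X Y : Subset k) e c → ¬ (e ∈ (insertAt X e c △ insertAt Y e c))
∉-△-insertAt X Y e c e∈ with trans (sym (insertAt-lookup (X △ Y) e false)) ([]=⇒lookup (subst (e ∈_) (△-insertAt X Y e c) e∈))
... | ()

exchange-slice : ∀ {k} (T : SetSystem (suc k)) e c → Exchange T → Exchange (slice T e c)
exchange-slice T e c exchange X Y TX TY u u∈
  with exchange (insertAt X e c) (insertAt Y e c) TX TY (punchIn e u) (∈-△-insertAt⁺ X Y e c u u∈)
... | v , v∈ , feasible with punchIn-view e v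
...   | inj₁ refl = ⊥-elim (∉-△-insertAt X Y e c v∈)
...   | inj₂ (v′ , refl) = v′ , ∈-△-insertAt⁻ X Y e c v′ v∈ , trans (cong T (sym (△-pair-insertAt X e c u v′))) feasible

exchange-unslice : ∀ {k} (T : SetSystem (suc k)) e c → Exchange (slice T e c) → ∀ X Y →
  T (insertAt X e c) ≡ true → T (insertAt Y e c) ≡ true → ∀ u → u ∈ (insertAt X e c △ insertAt Y e c) →
  ∃[ v ] (v ∈ (insertAt X e c △ insertAt Y e c) × T (insertAt X e c △ (⁅ u ⁆ ∪ ⁅ v ⁆)) ≡ true)
exchange-unslice T e c exchange X Y TX TY u u∈ with punchIn-view e u
... | inj₁ refl = ⊥-elim (∉-△-insertAt X Y e c u∈)
... | inj₂ (u′ , refl) with exchange X Y TX TY u′ (∈-△-insertAt⁻ X Y e c u′ u∈)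
...   | v′ , v′∈ , feasible =
  punchIn e v′ , ∈-△-insertAt⁺ X Y e c v′ v′∈ , trans (cong T (△-pair-insertAt X e c u′ v′)) feasible

data IteratedSlice {n} (S : SetSystem n) : ∀ {m} → SetSystem m → Set where
  slice-refl : IteratedSlice S S
  slice-step : ∀ {k} {M : SetSystem (suc k)} → IteratedSlice S M → ∀ e b → IteratedSlice S (slice M e b)

exchange-iteratedSlice : ∀ {n m} {S : SetSystem n} {M : SetSystem m} → Exchange S → IteratedSlice S M → Exchange M
exchange-iteratedSlice exchange slice-refl = exchange
exchange-iteratedSlice exchange (slice-step {M = M} sliceM e b) = exchange-slice M e b (exchange-iteratedSlice exchange sliceM)

if-slice : ∀ {k} (S : SetSystem (suc k)) e b {x y} →
  (if b then slice S e x else slice S e y) ≐ slice S e (if b then x else y)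
if-slice S e true F = refl
if-slice S e false F = refl

minor-as-slice : ∀ {k} φ (N : SetSystem (suc k)) e →
  Σ (Ops (suc k)) λ pre → Σ Bool λ c → minor φ N e ≐ slice (applyAll pre N) e c
minor-as-slice del N e = List.[] , _ , if-slice N e (isColoop N e)
minor-as-slice con N e = List.[] , _ , if-slice N e (isLoop N e)
minor-as-slice pen N e = lc ⁅ e ⁆ List.∷ List.[] , _ , if-slice (loopCompl N ⁅ e ⁆) e (isLoop (loopCompl N ⁅ e ⁆) e)

extend : ∀ {k} → Fin (suc k) → Op k → Op (suc k)
extend e (tw A) = tw (insertAt A e false)
extend e (lc A) = lc (insertAt A e false)

slice-extend : ∀ {k} (o : Op k) (P : SetSystem (suc k)) e c → slice (apply (extend e o) P) e c ≐ apply o (slice P e c)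
slice-extend (tw A) P e c F = trans (twist-slice P (insertAt A e false) e c (insertAt-lookup A e false) F)
  (cong₂ (λ c′ A′ → twist (slice P e c′) A′ F) (xor-identityʳ c) (removeAt-insertAt A e false))
slice-extend (lc A) P e false F = trans (lc-slice-false P (insertAt A e false) e F)
  (cong (λ A′ → loopCompl (slice P e false) A′ F) (removeAt-insertAt A e false))
slice-extend (lc A) P e true F = trans (lc-slice-true-∉ P (insertAt A e false) e (insertAt-lookup A e false) F)
  (cong (λ A′ → loopCompl (slice P e true) A′ F) (removeAt-insertAt A e false))

slice-extendAll : ∀ {k} (os : Ops k) (P : SetSystem (suc k)) e c →
  slice (applyAll (List.map (extend e) os) P) e c ≐ applyAll os (slice P e c)
slice-extendAll List.[] P e c F = refl
slice-extendAll (o List.∷ os) P e c F =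
  trans (slice-extendAll os (apply (extend e o) P) e c F) (applyAll-cong os (slice-extend o P e c) F)

SliceOfDual : ∀ {n m} → SetSystem n → SetSystem m → Set
SliceOfDual {n} {m} S M = Σ (SetSystem n) λ S′ → TwistedDual S S′ × Σ (SetSystem m) λ M′ → IteratedSlice S′ M′ × M′ ≐ M

-- One minor operation: slice at e, and extend the later operations past e.
sliceOfDual-step : ∀ {n k} {S : SetSystem n} {N : SetSystem (suc k)} φ e →
  (∀ os → SliceOfDual S (applyAll os N)) → ∀ os → SliceOfDual S (applyAll os (minor φ N e))
sliceOfDual-step {N = N} φ e sliceOfDualN os with minor-as-slice φ N e
... | pre , c , minor≐ with sliceOfDualN (pre ++ List.map (extend e) os)
...   | S′ , dual , M′ , sliceM′ , M′≐ = S′ , dual , slice M′ e c , slice-step sliceM′ e c , λ F → begin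
  slice M′ e c F                                                ≡⟨ M′≐ _ ⟩
  applyAll (pre ++ List.map (extend e) os) N (insertAt F e c)   ≡⟨ cong (λ S′ → S′ (insertAt F e c)) (applyAll-++ pre _ N) ⟩
  slice (applyAll (List.map (extend e) os) (applyAll pre N)) e c F ≡⟨ slice-extendAll os (applyAll pre N) e c F ⟩
  applyAll os (slice (applyAll pre N) e c) F                    ≡⟨ applyAll-cong os (λ G → sym (minor≐ G)) F ⟩
  applyAll os (minor φ N e) F                                   ∎
  where open ≡-Reasoning

sliceOfDual : ∀ {n m} {S : SetSystem n} {M : SetSystem m} → ThreeMinor S M → ∀ os → SliceOfDual S (applyAll os M)
sliceOfDual {S = S} tm-refl os = applyAll os S , twistedDual-applyAll os td-refl , applyAll os S , slice-refl , λ F → refl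
sliceOfDual (tm-delete minorN e) = sliceOfDual-step del e (sliceOfDual minorN)
sliceOfDual (tm-contract minorN e) = sliceOfDual-step con e (sliceOfDual minorN)
sliceOfDual (tm-penrose minorN e) = sliceOfDual-step pen e (sliceOfDual minorN)

vfSafe⇒exchange : ∀ {n m} {S : SetSystem n} {M : SetSystem m} → VfSafe S → ThreeMinor S M → ∀ os → Exchange (applyAll os M)
vfSafe⇒exchange (_ , dualsAreDeltaMatroids) minorM os with sliceOfDual minorM os
... | S′ , dual , M′ , sliceM′ , M′≐ =
  exchange-resp M′≐ (exchange-iteratedSlice (proj₂ (dualsAreDeltaMatroids S′ dual)) sliceM′)

data Constraint : Set where
  absent present either : Constraint

allows : Constraint → Bool → Bool
allows absent b = not b
allows present b = b
allows either b = true

flipC lcC : Constraint → Constraint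
flipC absent = present
flipC present = absent
flipC either = either
lcC absent = either
lcC present = present
lcC either = absent

box : ∀ {n} → (Fin n → Constraint) → SetSystem n
box {zero} c [] = true
box {suc n} c (b ∷ F) = allows (c zero) b ∧ box (λ i → c (suc i)) F

updateOn : ∀ {n} {X : Set} → Subset n → (X → X) → (Fin n → X) → Fin n → X
updateOn A h c i = if lookup A i then h (c i) else c i

allows-twist : ∀ a b c → allows c (b xor a) ≡ allows (if a then flipC c else c) b
allows-twist false false c = refl
allows-twist false true c = refl
allows-twist true false absent = refl
allows-twist true false present = refl
allows-twist true false either = refl
allows-twist true true absent = refl
allows-twist true true present = refl
allows-twist true true either = refl

box-twist : ∀ {n} (c : Fin n → Constraint) F A → box c (F △ A) ≡ box (updateOn A flipC c) F
box-twist {zero} c [] [] = refl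
box-twist {suc n} c (b ∷ F) (a ∷ A) = cong₂ _∧_ (allows-twist a b (c zero)) (box-twist (λ i → c (suc i)) F A)

lcRec-scale : ∀ {n} k (S : SetSystem n) A F → lcRec (λ G → k ∧ S G) A F ≡ k ∧ lcRec S A F
lcRec-scale true S A F = refl
lcRec-scale false S A F = lcRec-null (λ G → refl) A F

allows-lc-false : ∀ a c → allows (if a then lcC c else c) false ≡ allows c false
allows-lc-false false c = refl
allows-lc-false true absent = refl
allows-lc-false true present = refl
allows-lc-false true either = refl

allows-lc-true : ∀ c → allows (lcC c) true ≡ allows c false xor allows c true
allows-lc-true absent = refl
allows-lc-true present = refl
allows-lc-true either = refl

lcRec-box : ∀ {n} (c : Fin n → Constraint) A F → lcRec (box c) A F ≡ box (updateOn A lcC c) F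
lcRec-box {zero} c [] [] = refl
lcRec-box {suc n} c (a ∷ A) (false ∷ F) = trans (lcRec-scale (allows (c zero) false) _ A F)
  (cong₂ _∧_ (sym (allows-lc-false a (c zero))) (lcRec-box (λ i → c (suc i)) A F))
lcRec-box {suc n} c (false ∷ A) (true ∷ F) = trans (lcRec-scale (allows (c zero) true) _ A F)
  (cong (allows (c zero) true ∧_) (lcRec-box (λ i → c (suc i)) A F))
lcRec-box {suc n} c (true ∷ A) (true ∷ F) =
  trans (cong₂ _xor_ (lcRec-scale (allows (c zero) false) _ A F) (lcRec-scale (allows (c zero) true) _ A F))
  (trans (sym (∧-distribʳ-xor _ (allows (c zero) false) (allows (c zero) true)))
         (cong₂ _∧_ (sym (allows-lc-true (c zero))) (lcRec-box (λ i → c (suc i)) A F)))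

box-cong : ∀ {n} {c c′ : Fin n → Constraint} → (∀ i → c i ≡ c′ i) → box c ≐ box c′
box-cong {zero} c≡c′ [] = refl
box-cong {suc n} c≡c′ (b ∷ F) = cong₂ _∧_ (cong (λ x → allows x b) (c≡c′ zero)) (box-cong (λ i → c≡c′ (suc i)) F)

box-true⁻ : ∀ {n} (c : Fin n → Constraint) G → box c G ≡ true → ∀ i → allows (c i) (lookup G i) ≡ true
box-true⁻ {suc n} c (b ∷ G) inBox i with allows (c zero) b in allowed | inBox
box-true⁻ {suc n} c (b ∷ G) inBox zero | true | _ = allowed
box-true⁻ {suc n} c (b ∷ G) inBox (suc i) | true | inBox′ = box-true⁻ _ G inBox′ i

box-true⁺ : ∀ {n} (c : Fin n → Constraint) G → (∀ i → allows (c i) (lookup G i) ≡ true) → box c G ≡ true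
box-true⁺ {zero} c [] allowed = refl
box-true⁺ {suc n} c (b ∷ G) allowed rewrite allowed zero = box-true⁺ _ G (λ i → allowed (suc i))

box-false : ∀ {n} (c : Fin n → Constraint) G i → allows (c i) (lookup G i) ≡ false → box c G ≡ false
box-false c G i forbidden = ¬-not (λ inBox → case trans (sym forbidden) (box-true⁻ c G inBox i) of λ ())

box-iso : ∀ {m n} (σ : Fin m ↔ Fin n) (c : Fin n → Constraint) F →
  box c (imageSub σ F) ≡ box (λ i → c (Inverse.to σ i)) F
box-iso σ c F = ⇔→≡ {z = true} (mk⇔
  (λ inBox → box-true⁺ _ F (λ i → subst (λ b → allows (c (Inverse.to σ i)) b ≡ true)
     (trans (lookup∘tabulate _ (Inverse.to σ i)) (cong (lookup F) (Inverse.strictlyInverseʳ σ i)))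
     (box-true⁻ c _ inBox (Inverse.to σ i))))
  (λ inBox → box-true⁺ c _ (λ j → subst₂ (λ i b → allows (c i) b ≡ true) (Inverse.strictlyInverseˡ σ j)
     (sym (lookup∘tabulate _ j)) (box-true⁻ _ F inBox (Inverse.from σ j)))))

-- The six pairs of distinct constraints; pᵢⱼ stands for (i, j), where 0 is
-- absent, 1 present and * either.  Twisted duals of S₃ are xors of two boxes
-- whose constraints form such a pair at every element.
data Pair : Set where
  p01 p10 p*1 p1* p0* p*0 : Pair

fstP sndP : Pair → Constraint
fstP p01 = absent
fstP p10 = present
fstP p*1 = either
fstP p1* = present
fstP p0* = absent
fstP p*0 = either
sndP p01 = present
sndP p10 = absent
sndP p*1 = present
sndP p1* = either
sndP p0* = either
sndP p*0 = absent

flipP lcP : Pair → Pair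
flipP p01 = p10
flipP p10 = p01
flipP p*1 = p*0
flipP p*0 = p*1
flipP p1* = p0*
flipP p0* = p1*
lcP p01 = p*1
lcP p10 = p1*
lcP p*1 = p01
lcP p1* = p10
lcP p0* = p*0
lcP p*0 = p0*

pairSystem : ∀ {n} → (Fin n → Pair) → SetSystem n
pairSystem p = box (λ i → fstP (p i)) ⊕ box (λ i → sndP (p i))

pairSystem-cong : ∀ {n} {p p′ : Fin n → Pair} → (∀ i → p i ≡ p′ i) → pairSystem p ≐ pairSystem p′
pairSystem-cong p≡p′ F = cong₂ _xor_ (box-cong (λ i → cong fstP (p≡p′ i)) F) (box-cong (λ i → cong sndP (p≡p′ i)) F)

flipP-components : ∀ (l : Bool) p → (if l then flipC (fstP p) else fstP p) ≡ fstP (if l then flipP p else p)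
                                   × (if l then flipC (sndP p) else sndP p) ≡ sndP (if l then flipP p else p)
flipP-components false p = refl , refl
flipP-components true p01 = refl , refl
flipP-components true p10 = refl , refl
flipP-components true p*1 = refl , refl
flipP-components true p1* = refl , refl
flipP-components true p0* = refl , refl
flipP-components true p*0 = refl , refl

lcP-components : ∀ (l : Bool) p → (if l then lcC (fstP p) else fstP p) ≡ fstP (if l then lcP p else p)
                                 × (if l then lcC (sndP p) else sndP p) ≡ sndP (if l then lcP p else p)
lcP-components false p = refl , refl
lcP-components true p01 = refl , refl
lcP-components true p10 = refl , refl
lcP-components true p*1 = refl , refl
lcP-components true p1* = refl , refl
lcP-components true p0* = refl , refl
lcP-components true p*0 = refl , refl

twist-pairSystem : ∀ {n} (p : Fin n → Pair) A → twist (pairSystem p) A ≐ pairSystem (updateOn A flipP p)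
twist-pairSystem p A F = cong₂ _xor_
  (trans (box-twist _ F A) (box-cong (λ i → proj₁ (flipP-components (lookup A i) (p i))) F))
  (trans (box-twist _ F A) (box-cong (λ i → proj₂ (flipP-components (lookup A i) (p i))) F))

lc-pairSystem : ∀ {n} (p : Fin n → Pair) A → loopCompl (pairSystem p) A ≐ pairSystem (updateOn A lcP p)
lc-pairSystem p A F = trans (loopCompl≐lcRec _ A F) (trans (lcRec-⊕ _ _ A F) (cong₂ _xor_
  (trans (lcRec-box _ A F) (box-cong (λ i → proj₁ (lcP-components (lookup A i) (p i))) F))
  (trans (lcRec-box _ A F) (box-cong (λ i → proj₂ (lcP-components (lookup A i) (p i))) F))))

S₃-pairSystem : S₃ ≐ pairSystem (λ _ → p01)
S₃-pairSystem (false ∷ false ∷ false ∷ []) = refl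
S₃-pairSystem (false ∷ false ∷ true ∷ []) = refl
S₃-pairSystem (false ∷ true ∷ false ∷ []) = refl
S₃-pairSystem (false ∷ true ∷ true ∷ []) = refl
S₃-pairSystem (true ∷ false ∷ false ∷ []) = refl
S₃-pairSystem (true ∷ false ∷ true ∷ []) = refl
S₃-pairSystem (true ∷ true ∷ false ∷ []) = refl
S₃-pairSystem (true ∷ true ∷ true ∷ []) = refl

twistedDual-S₃ : ∀ {T : SetSystem 3} → TwistedDual S₃ T → Σ (Fin 3 → Pair) λ p → T ≐ pairSystem p
twistedDual-S₃ td-refl = (λ _ → p01) , S₃-pairSystem
twistedDual-S₃ (td-twist dual A) with twistedDual-S₃ dual
... | p , T≐ = updateOn A flipP p , λ F → trans (T≐ (F △ A)) (twist-pairSystem p A F)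
twistedDual-S₃ (td-lc dual A) with twistedDual-S₃ dual
... | p , T≐ = updateOn A lcP p , λ F → trans (apply-cong (lc A) T≐ F) (lc-pairSystem p A F)

pairSystem-iso : ∀ {m n} (σ : Fin m ↔ Fin n) (p : Fin n → Pair) F →
  pairSystem p (imageSub σ F) ≡ pairSystem (λ i → p (Inverse.to σ i)) F
pairSystem-iso σ p F = cong₂ _xor_ (box-iso σ _ F) (box-iso σ _ F)

-- Every pair is carried to p01 by a loop complementation, a twist and a
-- loop complementation at its element, each one applied or not.
lc₁? tw? lc₂? : Pair → Bool
lc₁? p01 = false
lc₁? p10 = false
lc₁? p*1 = true
lc₁? p1* = true
lc₁? p0* = true
lc₁? p*0 = false
tw? p01 = false
tw? p10 = true
tw? p*1 = false
tw? p1* = true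
tw? p0* = true
tw? p*0 = true
lc₂? p01 = false
lc₂? p10 = false
lc₂? p*1 = false
lc₂? p1* = false
lc₂? p0* = true
lc₂? p*0 = true

normalise-pair : ∀ p → let p₁ = if lc₁? p then lcP p else p
                           p₂ = if tw? p then flipP p₁ else p₁
                       in (if lc₂? p then lcP p₂ else p₂) ≡ p01
normalise-pair p01 = refl
normalise-pair p10 = refl
normalise-pair p*1 = refl
normalise-pair p1* = refl
normalise-pair p0* = refl
normalise-pair p*0 = refl

normalisingOps : ∀ {m} → (Fin m → Pair) → Ops m
normalisingOps q = lc (tabulate (λ i → lc₁? (q i))) List.∷ tw (tabulate (λ i → tw? (q i))) List.∷ lc (tabulate (λ i → lc₂? (q i))) List.∷ List.[]

normalise : ∀ {m} (q : Fin m → Pair) → applyAll (normalisingOps q) (pairSystem q) ≐ pairSystem (λ _ → p01)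
normalise q F =
  trans (apply-cong (lc A₃) (λ G → trans (apply-cong (tw A₂) (lc-pairSystem q A₁) G) (twist-pairSystem _ A₂ G)) F)
  (trans (lc-pairSystem _ A₃ F) (pairSystem-cong (λ i → trans (componentwise i) (normalise-pair (q i))) F))
  where
  A₁ = tabulate (λ i → lc₁? (q i))
  A₂ = tabulate (λ i → tw? (q i))
  A₃ = tabulate (λ i → lc₂? (q i))
  componentwise : ∀ i → updateOn A₃ lcP (updateOn A₂ flipP (updateOn A₁ lcP q)) i ≡ _
  componentwise i rewrite lookup∘tabulate (λ i → lc₁? (q i)) i | lookup∘tabulate (λ i → tw? (q i)) i
                        | lookup∘tabulate (λ i → lc₂? (q i)) i = refl

lookup-∅ : ∀ {n} (i : Fin n) → lookup ∅ i ≡ false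
lookup-∅ i = lookup-replicate i false

lookup-Full : ∀ {n} (i : Fin n) → lookup Full i ≡ true
lookup-Full i = lookup-replicate i true

lookup-⁅⁆-≢ : ∀ {n} (i j : Fin n) → i ≢ j → lookup ⁅ i ⁆ j ≡ false
lookup-⁅⁆-≢ i j i≢j = ¬-not (λ j∈ → x≢y⇒x∉⁅y⁆ (λ j≡i → i≢j (sym j≡i)) (lookup⇒[]= j ⁅ i ⁆ j∈))

lookup-∅△pair : ∀ {n} (u v j : Fin n) → lookup (∅ △ (⁅ u ⁆ ∪ ⁅ v ⁆)) j ≡ lookup ⁅ u ⁆ j ∨ lookup ⁅ v ⁆ j
lookup-∅△pair u v j = trans (lookup-zipWith _xor_ j ∅ _) (cong₂ _xor_ (lookup-∅ j) (lookup-zipWith _∨_ j ⁅ u ⁆ ⁅ v ⁆))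

∈-∅△Full : ∀ {n} (u : Fin n) → u ∈ (∅ △ Full)
∈-∅△Full u = lookup⇒[]= u _ (trans (lookup-zipWith _xor_ u ∅ Full) (cong₂ _xor_ (lookup-∅ u) (lookup-Full u)))

∅orFull : ∀ {m} → SetSystem m
∅orFull = pairSystem (λ _ → p01)

-- On a ground set with three distinct elements i₀, i₁, i₂ it violates
-- exchange: going from ∅ towards E through i₀ only reaches {i₀} or {i₀, v},
-- which misses i₁ or i₂.
¬exchange-∅orFull : ∀ {m} (i₀ i₁ i₂ : Fin m) → i₀ ≢ i₁ → i₀ ≢ i₂ → i₁ ≢ i₂ → ¬ Exchange (∅orFull {m})
¬exchange-∅orFull {m} i₀ i₁ i₂ i₀≢i₁ i₀≢i₂ i₁≢i₂ exchange
  with exchange ∅ Full ∅-feasible Full-feasible i₀ (∈-∅△Full i₀)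
  where
  ∅-feasible : ∅orFull {m} ∅ ≡ true
  ∅-feasible = cong₂ _xor_ (box-true⁺ {m} (λ _ → absent) ∅ (λ i → cong not (lookup-∅ i))) (box-false {m} (λ _ → present) ∅ i₀ (lookup-∅ i₀))
  Full-feasible : ∅orFull {m} Full ≡ true
  Full-feasible = cong₂ _xor_ (box-false {m} (λ _ → absent) Full i₀ (cong not (lookup-Full i₀))) (box-true⁺ {m} (λ _ → present) Full lookup-Full)
... | v , _ , feasible = case trans (sym pair-infeasible) feasible of λ ()
  where
  -- {i₀, v} is nonempty and misses i₂ (if v = i₁) or i₁ (otherwise)
  notFull : box (λ _ → present) (∅ △ (⁅ i₀ ⁆ ∪ ⁅ v ⁆)) ≡ false
  notFull with i₁ ≟ v
  ... | yes refl = box-false _ _ i₂ (trans (lookup-∅△pair i₀ i₁ i₂) (cong₂ _∨_ (lookup-⁅⁆-≢ i₀ i₂ i₀≢i₂) (lookup-⁅⁆-≢ i₁ i₂ i₁≢i₂)))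
  ... | no i₁≢v = box-false _ _ i₁ (trans (lookup-∅△pair i₀ v i₁)
                    (cong₂ _∨_ (lookup-⁅⁆-≢ i₀ i₁ i₀≢i₁) (lookup-⁅⁆-≢ v i₁ (λ v≡i₁ → i₁≢v (sym v≡i₁)))))
  pair-infeasible : ∅orFull (∅ △ (⁅ i₀ ⁆ ∪ ⁅ v ⁆)) ≡ false
  pair-infeasible = cong₂ _xor_
    (box-false (λ _ → absent) _ i₀ (cong not (trans (lookup-∅△pair i₀ v i₀) (cong (_∨ lookup ⁅ v ⁆ i₀) ([]=⇒lookup (x∈⁅x⁆ i₀)))))) notFull

vfSafe⇒noBadMinor : ∀ {n} (S : SetSystem n) → VfSafe S → ¬ HasBadMinor S
vfSafe⇒noBadMinor S vfSafe (m , M , minorM , T , dual , σ , M≅T) with twistedDual-S₃ dual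
... | p , T≐ = ¬exchange-∅orFull (from zero) (from (suc zero)) (from (suc (suc zero)))
                 (from-distinct λ ()) (from-distinct λ ()) (from-distinct λ ())
                 (exchange-resp normalised (vfSafe⇒exchange vfSafe minorM (normalisingOps q)))
  where
  open Inverse σ using (to; from; strictlyInverseˡ)
  q : Fin m → Pair
  q i = p (to i)
  M≐ : M ≐ pairSystem q
  M≐ F = trans (M≅T F) (trans (T≐ _) (pairSystem-iso σ p F))
  normalised : applyAll (normalisingOps q) M ≐ ∅orFull
  normalised F = trans (applyAll-cong (normalisingOps q) M≐ F) (normalise q F)
  from-distinct : ∀ {a b} → a ≢ b → from a ≢ from b
  from-distinct a≢b fa≡fb = a≢b (trans (sym (strictlyInverseˡ _)) (trans (cong to fa≡fb) (strictlyInverseˡ _)))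

-- Exchange from ∅ to E through u fails in S.
Blocked : ∀ {n} → SetSystem n → Fin n → Set
Blocked S u = S ∅ ≡ true × S Full ≡ true × (∀ v → S (∅ △ (⁅ u ⁆ ∪ ⁅ v ⁆)) ≡ false)

blocked? : ∀ {n} → SetSystem n → Fin n → Bool
blocked? {n} S u = S ∅ ∧ S Full ∧ all (λ v → not (S (∅ △ (⁅ u ⁆ ∪ ⁅ v ⁆)))) (List.allFin n)

blocked?-complete : ∀ {n} (S : SetSystem n) u → Blocked S u → Bool.T (blocked? S u)
blocked?-complete {n} S u (S∅ , SFull , SW) rewrite S∅ | SFull =
  all⁻ _ {List.allFin n} (All.tabulate (λ {v} _ → subst (λ b → Bool.T (not b)) (sym (SW v)) _))

-- Set systems on Fin n as decision trees on the first element.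
Table : ℕ → Set
Table zero = Bool
Table (suc n) = Table n × Table n

fromTable : ∀ {n} → Table n → SetSystem n
fromTable {zero} b [] = b
fromTable {suc n} (t₀ , t₁) (false ∷ F) = fromTable t₀ F
fromTable {suc n} (t₀ , t₁) (true ∷ F) = fromTable t₁ F

toTable : ∀ {n} → SetSystem n → Table n
toTable {zero} S = S []
toTable {suc n} S = toTable (λ F → S (false ∷ F)) , toTable (λ F → S (true ∷ F))

fromTable-toTable : ∀ {n} (S : SetSystem n) → fromTable (toTable S) ≐ S
fromTable-toTable {zero} S [] = refl
fromTable-toTable {suc n} S (false ∷ F) = fromTable-toTable (λ G → S (false ∷ G)) F
fromTable-toTable {suc n} S (true ∷ F) = fromTable-toTable (λ G → S (true ∷ G)) F

allTables : ∀ n → List (Table n)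
allTables zero = false List.∷ true List.∷ List.[]
allTables (suc n) = List.cartesianProduct (allTables n) (allTables n)

∈-allTables : ∀ {n} (t : Table n) → t ∈ₗ allTables n
∈-allTables {zero} false = here refl
∈-allTables {zero} true = there (here refl)
∈-allTables {suc n} (t₀ , t₁) = ∈-cartesianProduct⁺ (∈-allTables t₀) (∈-allTables t₁)

-- Candidate normalisations S ↦ ((S * {u}) + B) * {u}.
conjugateLc : ∀ {n} → Fin n → Subset n → Ops n
conjugateLc u B = tw ⁅ u ⁆ List.∷ lc B List.∷ tw ⁅ u ⁆ List.∷ List.[]

agreesWithS₃? : SetSystem 3 → Subset 3 → Bool
agreesWithS₃? S F = isYes (S F Bool.≟ S₃ F)

equalsS₃? : SetSystem 3 → Bool
equalsS₃? S = all (agreesWithS₃? S) (allSubsets 3)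

normalisable? : SetSystem 3 → Fin 3 → Bool
normalisable? S u = any (λ B → equalsS₃? (applyAll (conjugateLc u B) S)) (allSubsets 3)

checkedAt? : Fin 3 → Table 3 → Bool
checkedAt? u t = not (blocked? (fromTable t) u) ∨ normalisable? (fromTable t) u

-- A finite check: on three elements, every blocked system is normalisable to S₃.
blocked⇒normalisable : ∀ u → Bool.T (all (checkedAt? u) (allTables 3))
blocked⇒normalisable zero = _
blocked⇒normalisable (suc zero) = _
blocked⇒normalisable (suc (suc zero)) = _

implication : ∀ a {b} → Bool.T a → Bool.T (not a ∨ b) → Bool.T b
implication true _ b = b

blocked⇒hasS₃Minor : ∀ (S : SetSystem 3) u → Blocked S u → HasS₃Minor S
blocked⇒hasS₃Minor S u (S∅ , SFull , SW) = applyAll (conjugateLc u B) S , twistedMinor-ops (conjugateLc u B) (twistedMinor-refl S) ,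
  λ F → trans (applyAll-cong (conjugateLc u B) (λ G → sym (fromTable-toTable S G)) F) (equalsS₃ F)
  where
  t = toTable S
  checked : Bool.T (not (blocked? (fromTable t) u) ∨ normalisable? (fromTable t) u)
  checked = All.lookup (all⁺ (checkedAt? u) (allTables 3) (blocked⇒normalisable u)) (∈-allTables t)
  blockedT : Bool.T (blocked? (fromTable t) u)
  blockedT = blocked?-complete (fromTable t) u
    (trans (fromTable-toTable S ∅) S∅ , trans (fromTable-toTable S Full) SFull , λ v → trans (fromTable-toTable S _) (SW v))
  normalisable : Bool.T (normalisable? (fromTable t) u)
  normalisable = implication (blocked? (fromTable t) u) blockedT checked
  witness : Σ (Subset 3) λ B → Bool.T (equalsS₃? (applyAll (conjugateLc u B) (fromTable t)))
  witness = satisfied (any⁻ _ (allSubsets 3) normalisable)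
  B = proj₁ witness
  equalsS₃ : applyAll (conjugateLc u B) (fromTable t) ≐ S₃
  equalsS₃ F = toWitness (All.lookup (all⁺ (agreesWithS₃? (applyAll (conjugateLc u B) (fromTable t))) (allSubsets 3) (proj₂ witness)) (∈-allSubsets F))

preferred-twistedMinor : ∀ {k} φ (T : SetSystem (suc k)) e → ¬ Null (preferred φ T e) → TwistedMinor T (preferred φ T e)
preferred-twistedMinor φ T e ¬null =
  twistedMinor-resp (twistedMinor-minor φ e (twistedMinor-refl T)) (proj₂ (minor-selects φ T e) ¬null)

S₃FreeExchange : ℕ → Set
S₃FreeExchange k = ∀ (T : SetSystem k) → ¬ HasS₃Minor T → Exchange T

ExchangeAt : ∀ {n} → SetSystem n → Subset n → Subset n → Fin n → Set
ExchangeAt T X Y u = ∃[ v ] (v ∈ (X △ Y) × T (X △ (⁅ u ⁆ ∪ ⁅ v ⁆)) ≡ true)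

exchangeAt? : ∀ {n} (T : SetSystem n) X Y u → Dec (ExchangeAt T X Y u)
exchangeAt? T X Y u = any? (λ v → (v ∈? (X △ Y)) ×-dec (T (X △ (⁅ u ⁆ ∪ ⁅ v ⁆)) Bool.≟ true))

-- If X and Y agree at e, exchange for them holds in T, since it holds in the
-- slice of T at e containing both, which is a smaller S₃-free system.
exchange-agreeing : ∀ {k} (T : SetSystem (suc k)) → ¬ HasS₃Minor T → S₃FreeExchange k →
  ∀ X Y → T X ≡ true → T Y ≡ true → ∀ u → u ∈ (X △ Y) → ∀ e → lookup X e ≡ lookup Y e → ExchangeAt T X Y u
exchange-agreeing T noS₃ ih X Y TX TY u u∈ e agree =
  subst₂ (λ X Y → T X ≡ true → T Y ≡ true → u ∈ (X △ Y) → ExchangeAt T X Y u) X≡ Y≡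
    (λ TX′ TY′ u∈′ → exchange-unslice T e c exchangeSlice (removeAt X e) (removeAt Y e) TX′ TY′ u u∈′) TX TY u∈
  where
  c = lookup X e
  X≡ : insertAt (removeAt X e) e c ≡ X
  X≡ = insertAt-removeAt X e
  Y≡ : insertAt (removeAt Y e) e c ≡ Y
  Y≡ = insertAt-removeAt′ Y e (sym agree)
  ¬null : ¬ Null (slice T e c)
  ¬null = feasible⇒¬null {F = removeAt X e} (trans (cong T X≡) TX)
  twistedMinor : TwistedMinor T (slice T e c)
  twistedMinor with c | ¬null
  ... | false | ¬null′ = preferred-twistedMinor del T e ¬null′
  ... | true | ¬null′ = preferred-twistedMinor con T e ¬null′
  exchangeSlice : Exchange (slice T e c)
  exchangeSlice = ih (slice T e c) (λ bad → noS₃ (hasS₃Minor-transfer twistedMinor bad))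

avoid-two : ∀ {k} (u v : Fin (suc (suc (suc k)))) → ∃[ b ] (u ≢ b × v ≢ b)
avoid-two u v with punchIn-view u v
... | inj₁ refl = punchIn u zero , (λ u≡ → punchInᵢ≢i u zero (sym u≡)) , (λ u≡ → punchInᵢ≢i u zero (sym u≡))
... | inj₂ (v′ , refl) = punchIn u (punchIn v′ zero) , (λ u≡ → punchInᵢ≢i u _ (sym u≡)) ,
                         (λ v≡ → punchInᵢ≢i v′ zero (sym (punchIn-injective u _ _ v≡)))

exchange⇒¬blocked : ∀ {n} {M : SetSystem n} → Exchange M → ∀ u → ¬ Blocked M u
exchange⇒¬blocked exchange u (M∅ , MFull , MW) with exchange ∅ Full M∅ MFull u (∈-∅△Full u)
... | v , _ , feasible = case trans (sym (MW v)) feasible of λ ()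

-- If T is blocked at u = punchIn a u′, the slice of T avoiding a is blocked at
-- u′ in the sense that it contains no set {u′, v′} …
blocked-slice-avoiding : ∀ {k} (T : SetSystem (suc k)) a u′ → Blocked T (punchIn a u′) →
  ∀ v′ → slice T a false (∅ △ (⁅ u′ ⁆ ∪ ⁅ v′ ⁆)) ≡ false
blocked-slice-avoiding T a u′ (_ , _ , TW) v′ =
  trans (cong T (trans (sym (△-pair-insertAt ∅ a false u′ v′)) (cong (_△ (⁅ punchIn a u′ ⁆ ∪ ⁅ punchIn a v′ ⁆)) (insertAt-∅ a))))
        (TW (punchIn a v′))

-- … and so is the slice containing a, when T is S₃-free on at least four
-- elements: if {u′, v′} were in it, then ∅ and {u, v, a} would be feasible in T
-- and agree at a third element b, so exchange-agreeing would unblock T.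
blocked-slice-containing : ∀ {k} (T : SetSystem (suc (suc (suc (suc k))))) → ¬ HasS₃Minor T →
  S₃FreeExchange (suc (suc (suc k))) → ∀ a u′ → Blocked T (punchIn a u′) →
  ∀ v′ → slice T a true (∅ △ (⁅ u′ ⁆ ∪ ⁅ v′ ⁆)) ≡ false
blocked-slice-containing T noS₃ ih a u′ (T∅ , _ , TW) v′ = ¬-not W∉slice
  where
  u = punchIn a u′
  W = ∅ △ (⁅ u′ ⁆ ∪ ⁅ v′ ⁆)
  W∉slice : slice T a true W ≢ true
  W∉slice feasible with avoid-two u′ v′
  ... | b , u′≢b , v′≢b with exchange-agreeing T noS₃ ih ∅ (insertAt W a true) T∅ feasible u u∈ (punchIn a b) agree
    where
    u∈ : u ∈ (∅ △ insertAt W a true)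
    u∈ = lookup⇒[]= u (∅ △ insertAt W a true) (trans (lookup-zipWith _xor_ u ∅ (insertAt W a true))
           (cong₂ _xor_ (lookup-∅ u) (trans (insertAt-punchIn W a true u′)
             (trans (lookup-∅△pair u′ v′ u′) (cong (_∨ lookup ⁅ v′ ⁆ u′) ([]=⇒lookup (x∈⁅x⁆ u′)))))))
    agree : lookup ∅ (punchIn a b) ≡ lookup (insertAt W a true) (punchIn a b)
    agree = trans (lookup-∅ (punchIn a b)) (sym (trans (insertAt-punchIn W a true b)
              (trans (lookup-∅△pair u′ v′ b) (cong₂ _∨_ (lookup-⁅⁆-≢ u′ b u′≢b) (lookup-⁅⁆-≢ v′ b v′≢b)))))
  ... | w , _ , feasible′ = case trans (sym (TW w)) feasible′ of λ ()

-- The slices x, y at a without and with a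
-- contain no {u′, v′}; x contains ∅ and y contains E.  Depending on x E and
-- y ∅, one of x (deletion), y (contraction) or x ⊕ y (Penrose contraction) is
-- a smaller S₃-free system blocked at u′, contradicting the induction hypothesis.
blocked-large : ∀ {k} (T : SetSystem (suc (suc (suc (suc k))))) → ¬ HasS₃Minor T → S₃FreeExchange (suc (suc (suc k))) →
  ∀ a u′ → ¬ Blocked T (punchIn a u′)
blocked-large {k} T noS₃ ih a u′ blocked@(T∅ , TFull , _) = byCases (x Full) (y ∅) refl refl
  where
  x y : SetSystem (suc (suc (suc k)))
  x = slice T a false
  y = slice T a true
  x∅ : x ∅ ≡ true
  x∅ = trans (cong T (insertAt-∅ a)) T∅
  yFull : y Full ≡ true
  yFull = trans (cong T (insertAt-Full a)) TFull
  xW = blocked-slice-avoiding T a u′ blocked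
  yW = blocked-slice-containing T noS₃ ih a u′ blocked
  minorBlocked : ∀ φ → ¬ Blocked (preferred φ T a) u′
  minorBlocked φ blockedM@(M∅ , _ , _) = exchange⇒¬blocked
    (ih (preferred φ T a) (λ bad → noS₃ (hasS₃Minor-transfer (preferred-twistedMinor φ T a (feasible⇒¬null M∅)) bad)))
    u′ blockedM
  byCases : ∀ xE y∅′ → x Full ≡ xE → y ∅ ≡ y∅′ → ⊥
  byCases true _ xFull _ = minorBlocked del (x∅ , xFull , xW)
  byCases false true xFull y∅ = minorBlocked con (y∅ , yFull , yW)
  byCases false false xFull y∅ =
    minorBlocked pen (cong₂ _xor_ x∅ y∅ , cong₂ _xor_ xFull yFull , λ v′ → cong₂ _xor_ (xW v′) (yW v′))

-- Exchange from ∅ to E can never be blocked in an S₃-free system, given the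
-- induction hypothesis: on one or two elements E is reached directly, on three
-- elements by the finite check, and on four or more by blocked-large.
blocked-impossible : ∀ k (T : SetSystem (suc k)) → ¬ HasS₃Minor T → S₃FreeExchange k → ∀ u → ¬ Blocked T u
blocked-impossible zero T _ _ zero (_ , TFull , TW) = case trans (sym (TW zero)) TFull of λ ()
blocked-impossible (suc zero) T _ _ zero (_ , TFull , TW) = case trans (sym (TW (suc zero))) TFull of λ ()
blocked-impossible (suc zero) T _ _ (suc zero) (_ , TFull , TW) = case trans (sym (TW zero)) TFull of λ ()
blocked-impossible (suc (suc zero)) T noS₃ _ u blocked = noS₃ (blocked⇒hasS₃Minor T u blocked)
blocked-impossible (suc (suc (suc k))) T noS₃ ih u blocked =
  blocked-large T noS₃ ih a (punchOut a≢u) (subst (Blocked T) (sym (punchIn-punchOut a≢u)) blocked)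
  where
  a = punchIn u zero
  a≢u : a ≢ u
  a≢u = punchInᵢ≢i u zero

∅-△ : ∀ {n} (X : Subset n) → ∅ △ X ≡ X
∅-△ [] = refl
∅-△ (x ∷ X) = cong (x ∷_) (∅-△ X)

Full-△ : ∀ {n} (X Y : Subset n) → (∀ e → lookup X e ≢ lookup Y e) → Full △ X ≡ Y
Full-△ [] [] _ = refl
Full-△ (x ∷ X) (y ∷ Y) differ =
  cong₂ _∷_ (sym (¬-not (λ y≡x → differ zero (sym y≡x)))) (Full-△ X Y (λ e → differ (suc e)))

xor-≢ : ∀ {x y} → x ≢ y → x xor y ≡ true
xor-≢ {false} {false} x≢y = ⊥-elim (x≢y refl)
xor-≢ {false} {true} _ = refl
xor-≢ {true} {false} _ = refl
xor-≢ {true} {true} x≢y = ⊥-elim (x≢y refl)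

-- If X
-- and Y agree somewhere, use exchange-agreeing; otherwise twisting by X turns
-- a failure of exchange into a blocked system, which is impossible.
exchange-step : ∀ {k} (T : SetSystem (suc k)) → ¬ HasS₃Minor T → S₃FreeExchange k →
  ∀ X Y → T X ≡ true → T Y ≡ true → ∀ u → u ∈ (X △ Y) → ¬ ¬ ExchangeAt T X Y u
exchange-step {k} T noS₃ ih X Y TX TY u u∈ none with any? (λ e → lookup X e Bool.≟ lookup Y e)
... | yes (e , agree) = none (exchange-agreeing T noS₃ ih X Y TX TY u u∈ e agree)
... | no ¬agree = blocked-impossible k (twist T X) noS₃′ ih u (twisted∅ , twistedFull , twistedW)
  where
  differ : ∀ e → lookup X e ≢ lookup Y e
  differ e agree = ¬agree (e , agree)
  noS₃′ : ¬ HasS₃Minor (twist T X)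
  noS₃′ bad = noS₃ (hasS₃Minor-transfer (twistedMinor-ops (tw X List.∷ List.[]) (twistedMinor-refl T)) bad)
  twisted∅ : twist T X ∅ ≡ true
  twisted∅ = trans (cong T (∅-△ X)) TX
  twistedFull : twist T X Full ≡ true
  twistedFull = trans (cong T (Full-△ X Y differ)) TY
  twistedW : ∀ v → twist T X (∅ △ (⁅ u ⁆ ∪ ⁅ v ⁆)) ≡ false
  twistedW v = ¬-not λ feasible → none (v , v∈ , trans (cong T reorder) feasible)
    where
    v∈ : v ∈ (X △ Y)
    v∈ = lookup⇒[]= v (X △ Y) (trans (lookup-zipWith _xor_ v X Y) (xor-≢ (differ v)))
    reorder : X △ (⁅ u ⁆ ∪ ⁅ v ⁆) ≡ (∅ △ (⁅ u ⁆ ∪ ⁅ v ⁆)) △ X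
    reorder = trans (zipWith-comm xor-comm X _) (cong (_△ X) (sym (∅-△ _)))

exchange-S₃Free : ∀ n → S₃FreeExchange n
exchange-S₃Free zero T _ X Y _ _ () _
exchange-S₃Free (suc k) T noS₃ X Y TX TY u u∈ with exchangeAt? T X Y u
... | yes found = found
... | no none = ⊥-elim (exchange-step T noS₃ (exchange-S₃Free k) X Y TX TY u u∈ none)

apply-proper : ∀ {n} (o : Op n) {S : SetSystem n} → Proper S → Proper (apply o S)
apply-proper o {S} (F , SF) with properOrNull (apply o S)
... | inj₁ proper = proper
... | inj₂ null = ⊥-elim (feasible⇒¬null SF (apply-null⁻ o null))

applyAll-proper : ∀ {n} (os : Ops n) {S : SetSystem n} → Proper S → Proper (applyAll os S)
applyAll-proper List.[] proper = proper
applyAll-proper (o List.∷ os) proper = applyAll-proper os (apply-proper o proper)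

-- Backward direction: a proper system without 3-minors isomorphic to twisted
-- duals of S₃ is vf-safe, since each of its twisted duals is proper and S₃-free.
noBadMinor⇒vfSafe : ∀ {n} (S : SetSystem n) → Proper S → ¬ HasBadMinor S → VfSafe S
noBadMinor⇒vfSafe {n} S proper noBad = deltaMatroid S td-refl , deltaMatroid
  where
  deltaMatroid : ∀ T → TwistedDual S T → DeltaMatroid T
  deltaMatroid T dual with twistedDual⇒ops dual
  ... | os , T≐ with applyAll-proper os proper
  ...   | F , feasible = (F , trans (T≐ F) feasible) , exchange-S₃Free n T noS₃
    where
    noS₃ : ¬ HasS₃Minor T
    noS₃ bad = noBad (hasS₃Minor⇒hasBadMinor
      (hasS₃Minor-transfer (twistedMinor-resp (twistedMinor-ops os (twistedMinor-refl S)) (λ G → sym (T≐ G))) bad))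

theorem4p4 : (n : ℕ) (S : SetSystem n) → Proper S →
  (VfSafe S → ¬ HasBadMinor S) × (¬ HasBadMinor S → VfSafe S)
theorem4p4 n S proper = vfSafe⇒noBadMinor S , noBadMinor⇒vfSafe S proper
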